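{- For each fixed (consistent) order type of $\rho$, the theory $MODDAG_\rho$ has quantifier elimination in the language $\mathcal{L}_{\rho\cdot,<}$.
   Context: $\mathcal{L}_{\rho\cdot,<}=\{+,-,0,<,\rho\cdot,\rho^{ -1}\cdot\}$. An ordered difference abelian group is an ordered abelian group in which $\rho\cdot$ and $\rho^{ -1}\cdot$ are mutually inverse order-preserving group automorphisms. For $L=m_k\rho^k+\dots+m_0\in\mathbb Z[\rho]$ write $L\cdot x:=m_k\rho^k\cdot x+\dots+m_0x$. $MODAG$ is the theory of ordered difference abelian groups satisfying Axiom OM: for each $L\in\mathbb Z[\rho]$, either $L\cdot x>0$ for all $x>0$, or $L\cdot x=0$ for all $x>0$, or $L\cdot x<0$ for all $x>0$. $MODDAG$ is $MODAG$ together with $\exists x\,(x\neq0)$ and, for each $L$, $\big(\forall\gamma\,(L\cdot\gamma=0)\big)\vee\big(\forall\gamma\,\exists\delta\,(L\cdot\delta=\gamma)\big)$. The order type of $\rho$ in a model $\Gamma$ is $\{L\in\mathbb Z[\rho]:\forall x\in\Gamma\,(x>0\to L\cdot x>0)\}$ (which, with Axiom OM, determines for every $L$ which of the three alternatives holds). $MODDAG_\rho$ is $MODDAG$ together with the axioms specifying, for each $L\in\mathbb Z[\rho]$, which alternative of Axiom OM holds, according to a fixed order type realized in some model. -}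

module Defs where

open import Data.Nat using (ℕ; zero; suc)
open import Data.Integer using (ℤ; +_; -[1+_])
open import Data.Fin using (Fin; zero; suc)
open import Data.List using (List; []; _∷_)
open import Data.Product using (Σ; _×_; _,_)
open import Data.Empty using (⊥)
open import Data.Vec.Functional using () renaming (_∷_ to _∷ᵃ_)
open import Relation.Nullary using (¬_)
open import Relation.Binary.PropositionalEquality using (_≡_)

-- Syntax of first-order logic over L_{ρ·,<} = {+, -, 0, <, ρ·, ρ⁻¹·}
-- (de Bruijn variables; Term n / Formula n have n free variables)

infixl 6 _⊕_
infix  4 _≐_ _≺_
infixr 3 _∧'_
infixr 2 _∨'_
infixr 1 _⇒'_

data Term (n : ℕ) : Set where
  var   : Fin n → Term n
  zer   : Term n
  _⊕_   : Term n → Term n → Term n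
  ⊖_    : Term n → Term n
  ρ·_   : Term n → Term n
  ρ⁻¹·_ : Term n → Term n

data Formula : ℕ → Set where
  ⊥'   : ∀ {n} → Formula n
  _≐_  : ∀ {n} → Term n → Term n → Formula n
  _≺_  : ∀ {n} → Term n → Term n → Formula n
  ¬'_  : ∀ {n} → Formula n → Formula n
  _∧'_ : ∀ {n} → Formula n → Formula n → Formula n
  _∨'_ : ∀ {n} → Formula n → Formula n → Formula n
  _⇒'_ : ∀ {n} → Formula n → Formula n → Formula n
  ∀'_  : ∀ {n} → Formula (suc n) → Formula n
  ∃'_  : ∀ {n} → Formula (suc n) → Formula n

data QF : ∀ {n} → Formula n → Set where
  qf⊥ : ∀ {n} → QF {n} ⊥'
  qf≐ : ∀ {n} (s t : Term n) → QF (s ≐ t)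
  qf≺ : ∀ {n} (s t : Term n) → QF (s ≺ t)
  qf¬ : ∀ {n} {φ : Formula n} → QF φ → QF (¬' φ)
  qf∧ : ∀ {n} {φ ψ : Formula n} → QF φ → QF ψ → QF (φ ∧' ψ)
  qf∨ : ∀ {n} {φ ψ : Formula n} → QF φ → QF ψ → QF (φ ∨' ψ)
  qf⇒ : ∀ {n} {φ ψ : Formula n} → QF φ → QF ψ → QF (φ ⇒' ψ)

record Structure : Set₁ where
  field
    Carrier : Set
    𝟘       : Carrier
    _+_     : Carrier → Carrier → Carrier
    -_      : Carrier → Carrier
    ρ       : Carrier → Carrier
    ρ⁻¹     : Carrier → Carrier
    _<_     : Carrier → Carrier → Set

module _ (M : Structure) where
  open Structure M

  ⟦_⟧ : ∀ {n} → Term n → (Fin n → Carrier) → Carrier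
  ⟦ var i   ⟧ a = a i
  ⟦ zer     ⟧ a = 𝟘
  ⟦ s ⊕ t   ⟧ a = ⟦ s ⟧ a + ⟦ t ⟧ a
  ⟦ ⊖ t     ⟧ a = - ⟦ t ⟧ a
  ⟦ ρ· t    ⟧ a = ρ (⟦ t ⟧ a)
  ⟦ ρ⁻¹· t  ⟧ a = ρ⁻¹ (⟦ t ⟧ a)

  -- Tarskian satisfaction, read classically via the double-negation
  -- (Gödel–Gentzen) translation.
  Sat : ∀ {n} → (Fin n → Carrier) → Formula n → Set
  Sat a ⊥'        = ⊥
  Sat a (s ≐ t)   = ¬ ¬ (⟦ s ⟧ a ≡ ⟦ t ⟧ a)
  Sat a (s ≺ t)   = ¬ ¬ (⟦ s ⟧ a < ⟦ t ⟧ a)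
  Sat a (¬' φ)    = ¬ Sat a φ
  Sat a (φ ∧' ψ)  = Sat a φ × Sat a ψ
  Sat a (φ ∨' ψ)  = ¬ ((¬ Sat a φ) × (¬ Sat a ψ))
  Sat a (φ ⇒' ψ)  = Sat a φ → Sat a ψ
  Sat a (∀' φ)    = (x : Carrier) → Sat (x ∷ᵃ a) φ
  Sat a (∃' φ)    = ¬ ((x : Carrier) → ¬ Sat (x ∷ᵃ a) φ)

Sentence : Set
Sentence = Formula 0

Theory : Set₁
Theory = Sentence → Set

_⊨_ : Structure → Sentence → Set
M ⊨ φ = Sat M (λ ()) φ

Models : Theory → Structure → Set
Models T M = (φ : Sentence) → T φ → M ⊨ φ

-- L = m₀ + m₁ρ + … + m_kρ^k is represented by the list m₀ ∷ m₁ ∷ … ∷ m_k ∷ []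
Poly : Set
Poly = List ℤ

natmul : ∀ {n} → ℕ → Term n → Term n
natmul zero    t = zer
natmul (suc k) t = t ⊕ natmul k t

intmul : ∀ {n} → ℤ → Term n → Term n
intmul (+ k)     t = natmul k t
intmul -[1+ k ]  t = ⊖ natmul (suc k) t

_·_ : ∀ {n} → Poly → Term n → Term n
[]      · t = zer
(m ∷ L) · t = intmul m t ⊕ (L · (ρ· t))

private
  v0 : ∀ {n} → Term (suc n)
  v0 = var zero
  v1 : ∀ {n} → Term (suc (suc n))
  v1 = var (suc zero)
  v2 : ∀ {n} → Term (suc (suc (suc n)))
  v2 = var (suc (suc zero))

OM : Poly → Sentence
OM L = (∀' (zer ≺ v0 ⇒' zer ≺ L · v0))
    ∨' ((∀' (zer ≺ v0 ⇒' L · v0 ≐ zer))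
    ∨' (∀' (zer ≺ v0 ⇒' L · v0 ≺ zer)))

data MODAG : Theory where
  add-assoc : MODAG (∀' ∀' ∀' ((v2 ⊕ v1) ⊕ v0 ≐ v2 ⊕ (v1 ⊕ v0)))
  add-comm  : MODAG (∀' ∀' (v1 ⊕ v0 ≐ v0 ⊕ v1))
  add-idˡ   : MODAG (∀' (zer ⊕ v0 ≐ v0))
  add-invʳ  : MODAG (∀' (v0 ⊕ (⊖ v0) ≐ zer))
  lt-irrefl : MODAG (∀' (¬' (v0 ≺ v0)))
  lt-trans  : MODAG (∀' ∀' ∀' ((v2 ≺ v1 ∧' v1 ≺ v0) ⇒' v2 ≺ v0))
  lt-total  : MODAG (∀' ∀' (v1 ≺ v0 ∨' (v1 ≐ v0 ∨' v0 ≺ v1)))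
  lt-add    : MODAG (∀' ∀' ∀' (v2 ≺ v1 ⇒' v2 ⊕ v0 ≺ v1 ⊕ v0))
  ρ-add     : MODAG (∀' ∀' (ρ· (v1 ⊕ v0) ≐ (ρ· v1) ⊕ (ρ· v0)))
  ρ⁻¹-add   : MODAG (∀' ∀' (ρ⁻¹· (v1 ⊕ v0) ≐ (ρ⁻¹· v1) ⊕ (ρ⁻¹· v0)))
  ρ-mono    : MODAG (∀' ∀' (v1 ≺ v0 ⇒' ρ· v1 ≺ ρ· v0))
  ρ⁻¹-mono  : MODAG (∀' ∀' (v1 ≺ v0 ⇒' ρ⁻¹· v1 ≺ ρ⁻¹· v0))
  ρρ⁻¹      : MODAG (∀' (ρ· (ρ⁻¹· v0) ≐ v0))
  ρ⁻¹ρ      : MODAG (∀' (ρ⁻¹· (ρ· v0) ≐ v0))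
  om        : (L : Poly) → MODAG (OM L)

Nontrivial : Sentence
Nontrivial = ∃' (¬' (v0 ≐ zer))

Div : Poly → Sentence
Div L = (∀' (L · v0 ≐ zer)) ∨' (∀' ∃' (L · v0 ≐ v1))

data Sign : Set where
  pos zro neg : Sign

SignAx : Sign → Poly → Sentence
SignAx pos L = ∀' (zer ≺ v0 ⇒' zer ≺ L · v0)
SignAx zro L = ∀' (zer ≺ v0 ⇒' L · v0 ≐ zer)
SignAx neg L = ∀' (zer ≺ v0 ⇒' L · v0 ≺ zer)

-- An order type of ρ, given as its sign pattern σ : Z[ρ] → {>0, =0, <0}
OrderType : Set
OrderType = Poly → Sign

data MODDAG : Theory where
  base    : ∀ {φ} → MODAG φ → MODDAG φ
  nontriv : MODDAG Nontrivial
  div     : (L : Poly) → MODDAG (Div L)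

data MODDAGρ (σ : OrderType) : Theory where
  base : ∀ {φ} → MODDAG φ → MODDAGρ σ φ
  sign : (L : Poly) → MODDAGρ σ (SignAx (σ L) L)

Realized : OrderType → Set₁
Realized σ = ¬ ¬ (Σ Structure λ M →
  Models MODAG M × (M ⊨ Nontrivial) × ((L : Poly) → M ⊨ SignAx (σ L) L))

QE : Theory → Set₁
QE T = ∀ n (φ : Formula n) → ¬ ¬ (Σ (Formula n) λ ψ → QF ψ ×
  ((M : Structure) → Models T M → (a : Fin n → Structure.Carrier M) →
     (Sat M a φ → Sat M a ψ) × (Sat M a ψ → Sat M a φ)))

-- Quantifiers are eliminated one at a time, innermost first.  Once the matrix
-- of ∃x is in disjunctive normal form it suffices to eliminate x from a
-- conjunction of atoms.  Moving everything to one side, an atom reads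
-- ρ^{-K}(L·x) ∼ a with a free of x; the order type σ fixes the sign of L, so
-- the atom either does not depend on x or becomes a constraint L·x ∼ b with
-- L positive.  Multiplication by a positive L is an order-preserving injective
-- endomorphism, and divisibility makes it surjective.  If some constraint is
-- an equation L₀·x = b₀, multiplying every other constraint by L₀ (ℤ[ρ] is
-- commutative) lets b₀ replace L₀·x.  Otherwise the constraints are lower
-- bounds a < L·x and upper bounds K·x < b, and they are jointly satisfiable
-- iff K·a < L·b for every pair: pulling each bound back along its coefficient
-- leaves finitely many points below and above x, and a point strictly between
-- them exists because the order is dense and has no endpoints.  All reasoning
-- takes place in the double-negation fragment in which satisfaction is read.
module Submission where

open import Level using (0ℓ)
open import Defs
open import Algebra.Bundles using (AbelianGroup)
open import Algebra.Structures using (IsAbelianGroup)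
import Algebra.Properties.AbelianGroup as AbelianGroupProperties
import Algebra.Properties.CommutativeSemigroup as CommutativeSemigroupProperties
import Algebra.Properties.Monoid.Mult as MonoidMultiples
open import Data.Nat as ℕ using (ℕ; zero; suc)
open import Data.Integer as ℤ using (ℤ; +_; -[1+_])
import Data.Integer.Properties as ℤ
import Data.Nat.Properties as ℕ
open import Data.Fin using (Fin; zero; suc)
open import Data.List using (List; []; _∷_; _++_; map; cartesianProductWith; partitionSums)
open import Data.List.Relation.Unary.All as All using (All; []; _∷_)
open import Data.List.Relation.Unary.Any using (here; there)
open import Data.List.Membership.Propositional using (_∈_)
open import Data.List.Relation.Unary.All.Properties using (++⁺; ++⁻; ++⁻ˡ; ++⁻ʳ; map⁺; map⁻)
open import Data.List.Relation.Binary.Pointwise using (Pointwise; []; _∷_)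
open import Data.Maybe using (Maybe; just; nothing)
open import Data.Product using (Σ; _×_; _,_; proj₁; proj₂)
open import Data.Product.Function.NonDependent.Propositional using (_×-⇔_)
open import Data.Sum using (_⊎_; inj₁; inj₂; [_,_])
open import Data.Unit using (⊤; tt)
open import Data.Empty using (⊥; ⊥-elim)
open import Data.Vec.Functional using () renaming (_∷_ to _∷ᵃ_)
open import Function.Base using (_∘_)
open import Function.Bundles using (_⇔_; mk⇔; Equivalence)
open import Function.Properties.Equivalence using ()
  renaming (refl to ⇔-refl; sym to ⇔-sym; trans to ⇔-trans)
open import Function.Related.Propositional using (equivalence; module EquationalReasoning)
open import Relation.Binary.Structures using (IsEquivalence)
open import Relation.Nullary using (¬_; yes; no)
open import Relation.Nullary.Decidable using (¬¬-excluded-middle)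
open import Relation.Nullary.Negation using (Stable; negated-stable; ¬¬-map)
import Relation.Binary.PropositionalEquality as ≡
open ≡ using (_≡_)

open Equivalence using (to; from)

variable
  n : ℕ

-- Classical logic in the double-negation fragment

module _ where
  private variable
    A B A′ B′ : Set

  Stable-⊥ : Stable ⊥
  Stable-⊥ ¬¬⊥ = ¬¬⊥ (λ x → x)

  Stable-× : Stable A → Stable B → Stable (A × B)
  Stable-× sA sB ¬¬ab = sA (¬¬-map proj₁ ¬¬ab) , sB (¬¬-map proj₂ ¬¬ab)

  Stable-Π : {P : A → Set} → (∀ x → Stable (P x)) → Stable (∀ x → P x)
  Stable-Π sP ¬¬f x = sP x (¬¬-map (λ f → f x) ¬¬f)

  Stable-All : {P : A → Set} → (∀ x → Stable (P x)) → ∀ xs → Stable (All P xs)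
  Stable-All sP []       _    = []
  Stable-All sP (x ∷ xs) ¬¬ps =
    sP x (¬¬-map All.head ¬¬ps) ∷ Stable-All sP xs (¬¬-map All.tail ¬¬ps)

  infixr 2 _∨ᶜ_
  _∨ᶜ_ : Set → Set → Set
  A ∨ᶜ B = ¬ (¬ A × ¬ B)

  ∃ᶜ : (A → Set) → Set
  ∃ᶜ P = ¬ (∀ x → ¬ P x)

  ¬-⇔ : A ⇔ B → (¬ A) ⇔ (¬ B)
  ¬-⇔ A⇔B = mk⇔ (λ ¬a b → ¬a (from A⇔B b)) (λ ¬b a → ¬b (to A⇔B a))

  →-⇔ : A ⇔ A′ → B ⇔ B′ → (A → B) ⇔ (A′ → B′)
  →-⇔ A⇔A′ B⇔B′ = mk⇔ (λ f → to B⇔B′ ∘ f ∘ from A⇔A′) (λ f → from B⇔B′ ∘ f ∘ to A⇔A′)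

  ∨ᶜ-⇔ : A ⇔ A′ → B ⇔ B′ → (A ∨ᶜ B) ⇔ (A′ ∨ᶜ B′)
  ∨ᶜ-⇔ A⇔A′ B⇔B′ = ¬-⇔ (¬-⇔ A⇔A′ ×-⇔ ¬-⇔ B⇔B′)

  ∃ᶜ-⇔ : {P Q : A → Set} → (∀ x → P x ⇔ Q x) → ∃ᶜ P ⇔ ∃ᶜ Q
  ∃ᶜ-⇔ P⇔Q = ¬-⇔ (mk⇔ (λ f x → f x ∘ from (P⇔Q x)) (λ f x → f x ∘ to (P⇔Q x)))

  Stable⇒⇔¬¬ : Stable A → A ⇔ (¬ ¬ A)
  Stable⇒⇔¬¬ sA = mk⇔ (λ a ¬a → ¬a a) sA

  ¬¬-⇔ : Stable A → Stable B → ¬ ¬ (A ⇔ B) → A ⇔ B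
  ¬¬-⇔ sA sB ¬¬A⇔B = mk⇔ (λ a → sB (¬¬-map (λ A⇔B → to A⇔B a) ¬¬A⇔B))
                         (λ b → sA (¬¬-map (λ A⇔B → from A⇔B b) ¬¬A⇔B))

  ¬∨ᶜ¬⇔¬× : (¬ A ∨ᶜ ¬ B) ⇔ (¬ (A × B))
  ¬∨ᶜ¬⇔¬× = mk⇔ (λ h (a , b) → h ((λ ¬a → ¬a a) , (λ ¬b → ¬b b)))
                 (λ ¬ab (¬¬a , ¬¬b) → ¬¬a (λ a → ¬¬b (λ b → ¬ab (a , b))))

  ¬×¬⇔¬∨ᶜ : (¬ A × ¬ B) ⇔ (¬ (A ∨ᶜ B))
  ¬×¬⇔¬∨ᶜ = mk⇔ (λ ¬a¬b h → h ¬a¬b) (Stable-× negated-stable negated-stable)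

  ¬∨ᶜ⇔→ : Stable B → (¬ A ∨ᶜ B) ⇔ (A → B)
  ¬∨ᶜ⇔→ sB = mk⇔ (λ h a → sB (λ ¬b → h ((λ ¬a → ¬a a) , ¬b)))
                  (λ f (¬¬a , ¬b) → ¬¬a (λ a → ¬b (f a)))

  ×¬⇔¬→ : Stable A → (A × ¬ B) ⇔ (¬ (A → B))
  ×¬⇔¬→ sA = mk⇔ (λ (a , ¬b) f → ¬b (f a))
                  (λ ¬f → sA (λ ¬a → ¬f (λ a → ⊥-elim (¬a a))) , λ b → ¬f (λ _ → b))

  ∀⇔¬∃ᶜ¬ : {P : A → Set} → (∀ x → Stable (P x)) → (∀ x → P x) ⇔ (¬ ∃ᶜ (λ x → ¬ P x))
  ∀⇔¬∃ᶜ¬ sP = mk⇔ (λ f h → h (λ x ¬p → ¬p (f x)))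
                   (λ h x → sP x (λ ¬p → h (λ g → g x ¬p)))

  ∃ᶜ-×ˡ : {P : B → Set} → Stable A → ∃ᶜ (λ x → A × P x) ⇔ (A × ∃ᶜ P)
  ∃ᶜ-×ˡ sA = mk⇔ (λ h → sA (λ ¬a → h (λ x (a , _) → ¬a a)) , (λ f → h (λ x (_ , p) → f x p)))
                 (λ (a , h) f → h (λ x p → f x (a , p)))

  ∃ᶜ-¬All¬ : {P : A → B → Set} (xs : List B) →
             ∃ᶜ (λ a → ¬ All (λ x → ¬ P a x) xs) ⇔ (¬ All (λ x → ¬ ∃ᶜ (λ a → P a x)) xs)
  ∃ᶜ-¬All¬ {P = P} xs = mk⇔
    (λ h R → h (λ a ¬N → ¬N (All.map (λ ¬∃ p → ¬∃ (λ f → f a p)) R)))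
    (λ h f → h (All.map (λ ∀¬ ¬∀¬ → ¬∀¬ ∀¬)
                        (∀-All xs (λ a → Stable-All (λ _ → negated-stable) xs (f a)))))
    where
    ∀-All : ∀ ys → (∀ a → All (λ x → ¬ P a x) ys) → All (λ x → ∀ a → ¬ P a x) ys
    ∀-All []       _ = []
    ∀-All (y ∷ ys) g = (λ a → All.head (g a)) ∷ ∀-All ys (λ a → All.tail (g a))

module _ {A B D : Set} where
  All-cartesianProductWith : {P : D → Set} (f : A → B → D) (xs : List A) (ys : List B) →
    All P (cartesianProductWith f xs ys) ⇔ All (λ x → All (λ y → P (f x y)) ys) xs
  All-cartesianProductWith f []       ys = mk⇔ (λ _ → []) (λ _ → [])
  All-cartesianProductWith f (x ∷ xs) ys = mk⇔
    (λ ps → let (p , ps′) = ++⁻ (map (f x) ys) ps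
            in map⁻ p ∷ to (All-cartesianProductWith f xs ys) ps′)
    (λ { (p ∷ ps) → ++⁺ (map⁺ p) (from (All-cartesianProductWith f xs ys) ps) })

module _ {A B : Set} where
  All-map-⇔ : {P : A → Set} {Q : B → Set} {f : A → B} → (∀ x → P x ⇔ Q (f x)) →
              ∀ xs → All P xs ⇔ All Q (map f xs)
  All-map-⇔ P⇔Q xs = mk⇔ (λ ps → map⁺ (All.map (λ {x} → to (P⇔Q x)) ps))
                         (λ qs → All.map (λ {x} → from (P⇔Q x)) (map⁻ qs))

  All-partitionSums : {P : A → Set} {Q : B → Set} (xs : List (A ⊎ B)) →
    All [ P , Q ] xs ⇔ (All P (proj₁ (partitionSums xs)) × All Q (proj₂ (partitionSums xs)))
  All-partitionSums []            = mk⇔ (λ _ → [] , []) (λ _ → [])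
  All-partitionSums (inj₁ a ∷ xs) = mk⇔
    (λ { (p ∷ ps) → let (qs , rs) = to (All-partitionSums xs) ps in p ∷ qs , rs })
    (λ { (p ∷ qs , rs) → p ∷ from (All-partitionSums xs) (qs , rs) })
  All-partitionSums (inj₂ b ∷ xs) = mk⇔
    (λ { (p ∷ ps) → let (qs , rs) = to (All-partitionSums xs) ps in qs , p ∷ rs })
    (λ { (qs , p ∷ rs) → p ∷ from (All-partitionSums xs) (qs , rs) })

module _ {A B : Set} {R : A → B → Set} where
  All-along-⇔ : {P : A → Set} {Q : B → Set} → (∀ {x y} → R x y → P x ⇔ Q y) →
                ∀ {xs ys} → Pointwise R xs ys → All P xs ⇔ All Q ys
  All-along-⇔ P⇔Q []       = mk⇔ (λ _ → []) (λ _ → [])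
  All-along-⇔ P⇔Q (r ∷ rs) = ⇔-trans (mk⇔ All.uncons (λ (p , ps) → p ∷ ps))
    (⇔-trans (P⇔Q r ×-⇔ All-along-⇔ P⇔Q rs) (mk⇔ (λ (q , qs) → q ∷ qs) All.uncons))

  ¬¬-choose : {P : A → Set} → (∀ {x} → P x → ¬ ¬ Σ B (R x)) →
              ∀ {xs} → All P xs → ¬ ¬ Σ (List B) (Pointwise R xs)
  ¬¬-choose choose []       k = k ([] , [])
  ¬¬-choose choose (p ∷ ps) k =
    choose p (λ (y , r) → ¬¬-choose choose ps (λ (ys , rs) → k (y ∷ ys , r ∷ rs)))

-- The elimination procedure

shift : ℕ → Poly → Poly
shift zero    L = L
shift (suc j) L = + 0 ∷ shift j L

infixl 6 _+ₚ_
_+ₚ_ : Poly → Poly → Poly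
[]      +ₚ q       = q
(a ∷ p) +ₚ []      = a ∷ p
(a ∷ p) +ₚ (b ∷ q) = (a ℤ.+ b) ∷ (p +ₚ q)

-ₚ_ : Poly → Poly
-ₚ_ = map (λ m → ℤ.- m)

ρ^[_]_ : ℕ → Term n → Term n
ρ^[ zero  ] t = t
ρ^[ suc k ] t = ρ· ρ^[ k ] t

-- Represents the term ρ^{-depth} (coeff · x₀) + rest.
record Linear (n : ℕ) : Set where
  constructor linear
  field
    depth : ℕ
    coeff : Poly
    rest  : Term n

_+ₗ_ : Linear n → Linear n → Linear n
linear K₁ L₁ a₁ +ₗ linear K₂ L₂ a₂ =
  linear (K₁ ℕ.+ K₂) (shift K₂ L₁ +ₚ shift K₁ L₂) (a₁ ⊕ a₂)

-ₗ_ : Linear n → Linear n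
-ₗ linear K L a = linear K (-ₚ L) (⊖ a)

ρₗ : Linear n → Linear n
ρₗ (linear K L a) = linear K (shift 1 L) (ρ· a)

ρ⁻¹ₗ : Linear n → Linear n
ρ⁻¹ₗ (linear K L a) = linear (suc K) L (ρ⁻¹· a)

linearise : Term (suc n) → Linear n
linearise (var zero)    = linear 0 (+ 1 ∷ []) zer
linearise (var (suc i)) = linear 0 [] (var i)
linearise zer           = linear 0 [] zer
linearise (s ⊕ t)       = linearise s +ₗ linearise t
linearise (⊖ t)         = -ₗ linearise t
linearise (ρ· t)        = ρₗ (linearise t)
linearise (ρ⁻¹· t)      = ρ⁻¹ₗ (linearise t)

infix 4 _≐ᵃ_ _≺ᵃ_
data Atom (n : ℕ) : Set where
  _≐ᵃ_ _≺ᵃ_ : Term n → Term n → Atom n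

infix 4 _·x≐_ _·x≺_ _·x≻_
data Constraint (n : ℕ) : Set where
  _·x≐_ _·x≺_ _·x≻_ : Poly → Term n → Constraint n

coefficient : Constraint n → Poly
coefficient (L ·x≐ _) = L
coefficient (L ·x≺ _) = L
coefficient (L ·x≻ _) = L

solve≐ : Sign → Poly → Term n → Atom n ⊎ Constraint n
solve≐ pos L b = inj₂ (L ·x≐ b)
solve≐ zro L b = inj₁ (zer ≐ᵃ b)
solve≐ neg L b = inj₂ (-ₚ L ·x≐ ⊖ b)

solve≺ : Sign → Poly → Term n → Atom n ⊎ Constraint n
solve≺ pos L b = inj₂ (L ·x≺ b)
solve≺ zro L b = inj₁ (zer ≺ᵃ b)
solve≺ neg L b = inj₂ (-ₚ L ·x≻ ⊖ b)

-- s ∼ t with s - t = ρ^{-K} (L·x₀) + a becomes L·x₀ ∼ -ρ^K a, and the sign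
-- of L decides whether this constrains x₀ and in which direction.
isolate≐ isolate≺ : OrderType → Linear n → Atom n ⊎ Constraint n
isolate≐ σ (linear K L a) = solve≐ (σ L) L (⊖ ρ^[ K ] a)
isolate≺ σ (linear K L a) = solve≺ (σ L) L (⊖ ρ^[ K ] a)

isolate : OrderType → Atom (suc n) → Atom n ⊎ Constraint n
isolate σ (s ≐ᵃ t) = isolate≐ σ (linearise (s ⊕ ⊖ t))
isolate σ (s ≺ᵃ t) = isolate≺ σ (linearise (s ⊕ ⊖ t))

equationIn : List (Constraint n) → Maybe (Poly × Term n)
equationIn []               = nothing
equationIn ((L ·x≐ b) ∷ cs) = just (L , b)
equationIn ((L ·x≺ b) ∷ cs) = equationIn cs
equationIn ((L ·x≻ b) ∷ cs) = equationIn cs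

equationIn-∈ : ∀ (cs : List (Constraint n)) {L₀ b₀} →
               equationIn cs ≡ just (L₀ , b₀) → (L₀ ·x≐ b₀) ∈ cs
equationIn-∈ ((L ·x≐ b) ∷ cs) ≡.refl = here ≡.refl
equationIn-∈ ((L ·x≺ b) ∷ cs) eq     = there (equationIn-∈ cs eq)
equationIn-∈ ((L ·x≻ b) ∷ cs) eq     = there (equationIn-∈ cs eq)

-- Under L₀·x = b₀, multiplying L·x ∼ b by L₀ turns it into L·b₀ ∼ L₀·b.
substitute : Poly → Term n → Constraint n → Atom n
substitute L₀ b₀ (L ·x≐ b) = L · b₀ ≐ᵃ L₀ · b
substitute L₀ b₀ (L ·x≺ b) = L · b₀ ≺ᵃ L₀ · b
substitute L₀ b₀ (L ·x≻ b) = L₀ · b ≺ᵃ L · b₀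

lowerBound upperBound : Poly × Term n → Constraint n
lowerBound (L , a) = L ·x≻ a
upperBound (K , b) = K ·x≺ b

lowerBounds upperBounds : List (Constraint n) → List (Poly × Term n)
lowerBounds []               = []
lowerBounds ((L ·x≐ b) ∷ cs) = lowerBounds cs
lowerBounds ((L ·x≺ b) ∷ cs) = lowerBounds cs
lowerBounds ((L ·x≻ b) ∷ cs) = (L , b) ∷ lowerBounds cs
upperBounds []               = []
upperBounds ((L ·x≐ b) ∷ cs) = upperBounds cs
upperBounds ((L ·x≺ b) ∷ cs) = (L , b) ∷ upperBounds cs
upperBounds ((L ·x≻ b) ∷ cs) = upperBounds cs

module _ {P : Constraint n → Set} where
  lowerBounds-All : ∀ {cs} → All P cs → All (P ∘ lowerBound) (lowerBounds cs)
  lowerBounds-All []                       = []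
  lowerBounds-All {(_ ·x≐ _) ∷ _} (_ ∷ ps) = lowerBounds-All ps
  lowerBounds-All {(_ ·x≺ _) ∷ _} (_ ∷ ps) = lowerBounds-All ps
  lowerBounds-All {(_ ·x≻ _) ∷ _} (p ∷ ps) = p ∷ lowerBounds-All ps

  upperBounds-All : ∀ {cs} → All P cs → All (P ∘ upperBound) (upperBounds cs)
  upperBounds-All []                       = []
  upperBounds-All {(_ ·x≐ _) ∷ _} (_ ∷ ps) = upperBounds-All ps
  upperBounds-All {(_ ·x≺ _) ∷ _} (p ∷ ps) = p ∷ upperBounds-All ps
  upperBounds-All {(_ ·x≻ _) ∷ _} (_ ∷ ps) = upperBounds-All ps

  bounds-All⁻ : ∀ cs → equationIn cs ≡ nothing →
                All (P ∘ lowerBound) (lowerBounds cs) → All (P ∘ upperBound) (upperBounds cs) →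
                All P cs
  bounds-All⁻ []               _  _        _        = []
  bounds-All⁻ ((_ ·x≐ _) ∷ cs) ()
  bounds-All⁻ ((_ ·x≺ _) ∷ cs) eq ls       (u ∷ us) = u ∷ bounds-All⁻ cs eq ls us
  bounds-All⁻ ((_ ·x≻ _) ∷ cs) eq (l ∷ ls) us       = l ∷ bounds-All⁻ cs eq ls us

-- For positive K and L, some x has a < L·x and K·x < b iff K·a < L·b.
compatible : Poly × Term n → Poly × Term n → Atom n
compatible (L , a) (K , b) = K · a ≺ᵃ L · b

eliminateWith : Maybe (Poly × Term n) → List (Constraint n) → List (Atom n)
eliminateWith (just (L₀ , b₀)) cs = map (substitute L₀ b₀) cs
eliminateWith nothing          cs =
  cartesianProductWith compatible (lowerBounds cs) (upperBounds cs)

eliminate : List (Constraint n) → List (Atom n)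
eliminate cs = eliminateWith (equationIn cs) cs

Clause : ℕ → Set
Clause n = List (Atom n)

DNF : ℕ → Set
DNF n = List (Clause n)

eliminateClause : OrderType → Clause (suc n) → Clause n
eliminateClause σ c =
  let (atoms , constraints) = partitionSums (map (isolate σ) c) in atoms ++ eliminate constraints

infixr 7 _∧ᵈ_
_∧ᵈ_ : DNF n → DNF n → DNF n
_∧ᵈ_ = cartesianProductWith _++_

-- Junk on quantifiers: dnf is only applied to quantifier-free formulas.
dnf dnf¬ : Formula n → DNF n
dnf ⊥'       = []
dnf (s ≐ t)  = ((s ≐ᵃ t) ∷ []) ∷ []
dnf (s ≺ t)  = ((s ≺ᵃ t) ∷ []) ∷ []
dnf (¬' φ)   = dnf¬ φ
dnf (φ ∧' ψ) = dnf φ ∧ᵈ dnf ψ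
dnf (φ ∨' ψ) = dnf φ ++ dnf ψ
dnf (φ ⇒' ψ) = dnf¬ φ ++ dnf ψ
dnf (∀' φ)   = []
dnf (∃' φ)   = []
dnf¬ ⊥'       = [] ∷ []
dnf¬ (s ≐ t)  = ((s ≺ᵃ t) ∷ []) ∷ ((t ≺ᵃ s) ∷ []) ∷ []
dnf¬ (s ≺ t)  = ((s ≐ᵃ t) ∷ []) ∷ ((t ≺ᵃ s) ∷ []) ∷ []
dnf¬ (¬' φ)   = dnf φ
dnf¬ (φ ∧' ψ) = dnf¬ φ ++ dnf¬ ψ
dnf¬ (φ ∨' ψ) = dnf¬ φ ∧ᵈ dnf¬ ψ
dnf¬ (φ ⇒' ψ) = dnf φ ∧ᵈ dnf¬ ψ
dnf¬ (∀' φ)   = []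
dnf¬ (∃' φ)   = []

atomFormula : Atom n → Formula n
atomFormula (s ≐ᵃ t) = s ≐ t
atomFormula (s ≺ᵃ t) = s ≺ t

clauseFormula : Clause n → Formula n
clauseFormula []      = ¬' ⊥'
clauseFormula (a ∷ c) = atomFormula a ∧' clauseFormula c

dnfFormula : DNF n → Formula n
dnfFormula []      = ⊥'
dnfFormula (c ∷ D) = clauseFormula c ∨' dnfFormula D

∃-eliminate : OrderType → DNF (suc n) → Formula n
∃-eliminate σ D = dnfFormula (map (eliminateClause σ) D)

qe : OrderType → Formula n → Formula n
qe σ ⊥'       = ⊥'
qe σ (s ≐ t)  = s ≐ t
qe σ (s ≺ t)  = s ≺ t
qe σ (¬' φ)   = ¬' qe σ φ
qe σ (φ ∧' ψ) = qe σ φ ∧' qe σ ψ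
qe σ (φ ∨' ψ) = qe σ φ ∨' qe σ ψ
qe σ (φ ⇒' ψ) = qe σ φ ⇒' qe σ ψ
qe σ (∀' φ)   = ¬' ∃-eliminate σ (dnf¬ (qe σ φ))
qe σ (∃' φ)   = ∃-eliminate σ (dnf (qe σ φ))

qf-atomFormula : (a : Atom n) → QF (atomFormula a)
qf-atomFormula (s ≐ᵃ t) = qf≐ s t
qf-atomFormula (s ≺ᵃ t) = qf≺ s t

qf-clauseFormula : (c : Clause n) → QF (clauseFormula c)
qf-clauseFormula []      = qf¬ qf⊥
qf-clauseFormula (a ∷ c) = qf∧ (qf-atomFormula a) (qf-clauseFormula c)

qf-dnfFormula : (D : DNF n) → QF (dnfFormula D)
qf-dnfFormula []      = qf⊥
qf-dnfFormula (c ∷ D) = qf∨ (qf-clauseFormula c) (qf-dnfFormula D)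

qf-qe : ∀ σ (φ : Formula n) → QF (qe σ φ)
qf-qe σ ⊥'       = qf⊥
qf-qe σ (s ≐ t)  = qf≐ s t
qf-qe σ (s ≺ t)  = qf≺ s t
qf-qe σ (¬' φ)   = qf¬ (qf-qe σ φ)
qf-qe σ (φ ∧' ψ) = qf∧ (qf-qe σ φ) (qf-qe σ ψ)
qf-qe σ (φ ∨' ψ) = qf∨ (qf-qe σ φ) (qf-qe σ ψ)
qf-qe σ (φ ⇒' ψ) = qf⇒ (qf-qe σ φ) (qf-qe σ ψ)
qf-qe σ (∀' φ)   = qf¬ (qf-dnfFormula _)
qf-qe σ (∃' φ)   = qf-dnfFormula _

-- Models of MODAG

-- Satisfaction reads atomic formulas through ¬¬, so a model of MODAG is an
-- ordered abelian group for the equality ≈ = ¬¬≡ and the order ⊏ = ¬¬<.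
module OrderedGroup (M : Structure) (isModel : Models MODAG M) where
  open Structure M public
    using (𝟘; ρ; ρ⁻¹)
    renaming (Carrier to C; _+_ to infixl 6 _+_; -_ to infix 8 -_)

  Env : ℕ → Set
  Env n = Fin n → C

  ⟦_⟧ᴹ : Term n → Env n → C
  ⟦_⟧ᴹ = ⟦_⟧ M

  infix 4 _≈_ _⊏_
  _≈_ _⊏_ : C → C → Set
  a ≈ b = ¬ ¬ (a ≡ b)
  a ⊏ b = ¬ ¬ (Structure._<_ M a b)

  private
    holds : ∀ {φ} → MODAG φ → M ⊨ φ
    holds = isModel _

  ≈-cong : ∀ (f : C → C) {a b} → a ≈ b → f a ≈ f b
  ≈-cong f = ¬¬-map (≡.cong f)

  ≈-cong₂ : ∀ (f : C → C → C) {a b c d} → a ≈ b → c ≈ d → f a c ≈ f b d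
  ≈-cong₂ f a≈b c≈d ¬≡ = a≈b (λ a≡b → c≈d (λ c≡d → ¬≡ (≡.cong₂ f a≡b c≡d)))

  ≈-isEquivalence : IsEquivalence _≈_
  ≈-isEquivalence = record
    { refl  = λ ¬a≡a → ¬a≡a ≡.refl
    ; sym   = ¬¬-map ≡.sym
    ; trans = λ a≈b b≈c ¬a≡c → a≈b (λ a≡b → b≈c (λ b≡c → ¬a≡c (≡.trans a≡b b≡c)))
    }

  +-isAbelianGroup : IsAbelianGroup _≈_ _+_ 𝟘 -_
  +-isAbelianGroup = record
    { isGroup = record
      { isMonoid = record
        { isSemigroup = record
          { isMagma = record { isEquivalence = ≈-isEquivalence ; ∙-cong = ≈-cong₂ _+_ }
          ; assoc   = holds add-assoc
          }
        ; identity = holds add-idˡ , λ a → trans (holds add-comm a 𝟘) (holds add-idˡ a)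
        }
      ; inverse = (λ a → trans (holds add-comm (- a) a) (holds add-invʳ a)) , holds add-invʳ
      ; ⁻¹-cong = ≈-cong -_
      }
    ; comm = holds add-comm
    }
    where open IsEquivalence ≈-isEquivalence using (trans)

  +-abelianGroup : AbelianGroup 0ℓ 0ℓ
  +-abelianGroup = record { isAbelianGroup = +-isAbelianGroup }

  open AbelianGroup +-abelianGroup public
    using (setoid; monoid; commutativeSemigroup)
    renaming ( refl to ≈-refl; sym to ≈-sym; trans to ≈-trans; reflexive to ≈-reflexive
             ; ∙-cong to +-cong; ∙-congˡ to +-congˡ; ∙-congʳ to +-congʳ
             ; ⁻¹-cong to -‿cong; assoc to +-assoc; comm to +-comm
             ; identityˡ to +-identityˡ; identityʳ to +-identityʳ
             ; inverseˡ to -‿inverseˡ; inverseʳ to -‿inverseʳ )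
  open AbelianGroupProperties +-abelianGroup public
    using ( inverseˡ-unique; inverseʳ-unique; ⁻¹-involutive; ⁻¹-injective; ε⁻¹≈ε; ⁻¹-∙-comm
          ; identityʳ-unique; //-rightDividesˡ; //-rightDividesʳ; x∙y⁻¹≈ε⇒x≈y; x≈y⇒x∙y⁻¹≈ε )
  open CommutativeSemigroupProperties commutativeSemigroup public using (interchange)
  open MonoidMultiples monoid public
    using () renaming (_×_ to infixr 8 _×ₙ_; ×-homo-+ to ×ₙ-homo-+)
  open import Relation.Binary.Reasoning.Setoid setoid

  ρ-homo-+ : ∀ a b → ρ (a + b) ≈ ρ a + ρ b
  ρ-homo-+ = holds ρ-add

  ρ⁻¹-homo-+ : ∀ a b → ρ⁻¹ (a + b) ≈ ρ⁻¹ a + ρ⁻¹ b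
  ρ⁻¹-homo-+ = holds ρ⁻¹-add

  ρ-ρ⁻¹ : ∀ a → ρ (ρ⁻¹ a) ≈ a
  ρ-ρ⁻¹ = holds ρρ⁻¹

  ρ⁻¹-ρ : ∀ a → ρ⁻¹ (ρ a) ≈ a
  ρ⁻¹-ρ = holds ρ⁻¹ρ

  <-irrefl : ∀ a → ¬ a ⊏ a
  <-irrefl = holds lt-irrefl

  <-trans : ∀ {a b c} → a ⊏ b → b ⊏ c → a ⊏ c
  <-trans {a} {b} {c} a<b b<c = holds lt-trans a b c (a<b , b<c)

  <-trichotomy : ∀ a b → ¬ ¬ (a ⊏ b ⊎ a ≈ b ⊎ b ⊏ a)
  <-trichotomy a b k = holds lt-total a b
    ( (λ a<b → k (inj₁ a<b))
    , (λ ¬≈∨> → ¬≈∨> ((λ a≈b → k (inj₂ (inj₁ a≈b))) , (λ b<a → k (inj₂ (inj₂ b<a))))) )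

  +-monoˡ-< : ∀ c {a b} → a ⊏ b → a + c ⊏ b + c
  +-monoˡ-< c {a} {b} = holds lt-add a b c

  ρ-mono-< : ∀ {a b} → a ⊏ b → ρ a ⊏ ρ b
  ρ-mono-< {a} {b} = holds ρ-mono a b

  ρ⁻¹-mono-< : ∀ {a b} → a ⊏ b → ρ⁻¹ a ⊏ ρ⁻¹ b
  ρ⁻¹-mono-< {a} {b} = holds ρ⁻¹-mono a b

  <-resp-≈ : ∀ {a a′ b b′} → a ≈ a′ → b ≈ b′ → a ⊏ b → a′ ⊏ b′
  <-resp-≈ a≈a′ b≈b′ a<b ¬a′<b′ =
    a≈a′ (λ { ≡.refl → b≈b′ (λ { ≡.refl → a<b ¬a′<b′ }) })

  <-cases : ∀ {G : Set} → Stable G → ∀ a b →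
            (a ⊏ b → G) → (a ≈ b → G) → (b ⊏ a → G) → G
  <-cases stable a b lt eq gt = stable (λ ¬G → <-trichotomy a b λ
    { (inj₁ a<b)        → ¬G (lt a<b)
    ; (inj₂ (inj₁ a≈b)) → ¬G (eq a≈b)
    ; (inj₂ (inj₂ b<a)) → ¬G (gt b<a) })

  ≈⇒≮ : ∀ {a b} → a ≈ b → ¬ a ⊏ b
  ≈⇒≮ {a} a≈b a<b = <-irrefl a (<-resp-≈ ≈-refl (≈-sym a≈b) a<b)

  <-asym : ∀ {a b} → a ⊏ b → ¬ b ⊏ a
  <-asym {a} a<b b<a = <-irrefl a (<-trans a<b b<a)

  +-monoʳ-< : ∀ c {a b} → a ⊏ b → c + a ⊏ c + b
  +-monoʳ-< c a<b = <-resp-≈ (+-comm _ c) (+-comm _ c) (+-monoˡ-< c a<b)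

  +-cancelʳ-< : ∀ c {a b} → a + c ⊏ b + c → a ⊏ b
  +-cancelʳ-< c {a} {b} a+c<b+c =
    <-resp-≈ (//-rightDividesʳ c a) (//-rightDividesʳ c b) (+-monoˡ-< (- c) a+c<b+c)

  <⇔-<𝟘 : ∀ {a b} → (a ⊏ b) ⇔ (a + - b ⊏ 𝟘)
  <⇔-<𝟘 {a} {b} = mk⇔
    (λ a<b → <-resp-≈ ≈-refl (-‿inverseʳ b) (+-monoˡ-< (- b) a<b))
    (λ a-b<𝟘 → +-cancelʳ-< (- b) (<-resp-≈ ≈-refl (≈-sym (-‿inverseʳ b)) a-b<𝟘))

  <⇔𝟘<- : ∀ {a b} → (a ⊏ b) ⇔ (𝟘 ⊏ b + - a)
  <⇔𝟘<- {a} {b} = mk⇔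
    (λ a<b → <-resp-≈ (-‿inverseʳ a) ≈-refl (+-monoˡ-< (- a) a<b))
    (λ 𝟘<b-a → <-resp-≈ (+-identityˡ a) (//-rightDividesˡ a b) (+-monoˡ-< a 𝟘<b-a))

  +<𝟘⇔<- : ∀ {a b} → (a + b ⊏ 𝟘) ⇔ (a ⊏ - b)
  +<𝟘⇔<- {a} {b} = mk⇔
    (λ a+b<𝟘 → +-cancelʳ-< b (<-resp-≈ ≈-refl (≈-sym (-‿inverseˡ b)) a+b<𝟘))
    (λ a<-b → <-resp-≈ ≈-refl (-‿inverseˡ b) (+-monoˡ-< b a<-b))

  ≈⇔-≈𝟘 : ∀ {a b} → (a ≈ b) ⇔ (a + - b ≈ 𝟘)
  ≈⇔-≈𝟘 = mk⇔ x≈y⇒x∙y⁻¹≈ε (x∙y⁻¹≈ε⇒x≈y _ _)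

  +≈𝟘⇔≈- : ∀ {a b} → (a + b ≈ 𝟘) ⇔ (a ≈ - b)
  +≈𝟘⇔≈- {a} {b} = mk⇔ (inverseˡ-unique a b) (λ a≈-b → ≈-trans (+-congʳ a≈-b) (-‿inverseˡ b))

  -‿anti-< : ∀ {a b} → a ⊏ b → - b ⊏ - a
  -‿anti-< {a} {b} a<b = to +<𝟘⇔<- (<-resp-≈ (+-comm a (- b)) ≈-refl (to <⇔-<𝟘 a<b))

  <𝟘⇒𝟘<- : ∀ {a} → a ⊏ 𝟘 → 𝟘 ⊏ - a
  <𝟘⇒𝟘<- a<𝟘 = <-resp-≈ ε⁻¹≈ε ≈-refl (-‿anti-< a<𝟘)

  𝟘<⇒-<𝟘 : ∀ {a} → 𝟘 ⊏ a → - a ⊏ 𝟘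
  𝟘<⇒-<𝟘 𝟘<a = <-resp-≈ ≈-refl ε⁻¹≈ε (-‿anti-< 𝟘<a)

  -‿anti-<⇔ : ∀ {a b} → (a ⊏ b) ⇔ (- b ⊏ - a)
  -‿anti-<⇔ = mk⇔ -‿anti-<
    (λ -b<-a → <-resp-≈ (⁻¹-involutive _) (⁻¹-involutive _) (-‿anti-< -b<-a))

  -‿≈⇔ : ∀ {a b} → (a ≈ b) ⇔ (- a ≈ - b)
  -‿≈⇔ = mk⇔ -‿cong ⁻¹-injective

  ≈-resp-⇔ : ∀ {a a′ b b′} → a ≈ a′ → b ≈ b′ → (a ≈ b) ⇔ (a′ ≈ b′)
  ≈-resp-⇔ a≈a′ b≈b′ = mk⇔ (λ a≈b → ≈-trans (≈-sym a≈a′) (≈-trans a≈b b≈b′))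
                           (λ a′≈b′ → ≈-trans a≈a′ (≈-trans a′≈b′ (≈-sym b≈b′)))

  <-resp-⇔ : ∀ {a a′ b b′} → a ≈ a′ → b ≈ b′ → (a ⊏ b) ⇔ (a′ ⊏ b′)
  <-resp-⇔ a≈a′ b≈b′ = mk⇔ (<-resp-≈ a≈a′ b≈b′) (<-resp-≈ (≈-sym a≈a′) (≈-sym b≈b′))

  ≉⇔<∨> : ∀ {a b} → (¬ a ≈ b) ⇔ (a ⊏ b ∨ᶜ b ⊏ a)
  ≉⇔<∨> {a} {b} = mk⇔
    (λ a≉b (a≮b , b≮a) → <-cases Stable-⊥ a b a≮b a≉b b≮a)
    (λ h a≈b → h (≈⇒≮ a≈b , ≈⇒≮ (≈-sym a≈b)))

  ≮⇔≈∨> : ∀ {a b} → (¬ a ⊏ b) ⇔ (a ≈ b ∨ᶜ b ⊏ a)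
  ≮⇔≈∨> {a} {b} = mk⇔
    (λ a≮b (a≉b , b≮a) → <-cases Stable-⊥ a b a≮b a≉b b≮a)
    (λ h a<b → h ((λ a≈b → ≈⇒≮ a≈b a<b) , <-asym a<b))

  -- The action of ℤ[ρ]

  infixr 8 _×ᵢ_
  _×ᵢ_ : ℤ → C → C
  (+ k)    ×ᵢ y = k ×ₙ y
  -[1+ k ] ×ᵢ y = - (suc k ×ₙ y)

  infixr 8 _⊛_
  _⊛_ : Poly → C → C
  []      ⊛ y = 𝟘
  (m ∷ L) ⊛ y = m ×ᵢ y + L ⊛ ρ y

  ⟦·⟧ : ∀ L (t : Term n) e → ⟦ L · t ⟧ᴹ e ≡ L ⊛ ⟦ t ⟧ᴹ e
  ⟦·⟧ []      t e = ≡.refl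
  ⟦·⟧ (m ∷ L) t e = ≡.cong₂ _+_ (⟦intmul⟧ m) (⟦·⟧ L (ρ· t) e)
    where
    ⟦natmul⟧ : ∀ k → ⟦ natmul k t ⟧ᴹ e ≡ k ×ₙ ⟦ t ⟧ᴹ e
    ⟦natmul⟧ zero    = ≡.refl
    ⟦natmul⟧ (suc k) = ≡.cong (_+_ (⟦ t ⟧ᴹ e)) (⟦natmul⟧ k)
    ⟦intmul⟧ : ∀ m → ⟦ intmul m t ⟧ᴹ e ≡ m ×ᵢ ⟦ t ⟧ᴹ e
    ⟦intmul⟧ (+ k)    = ⟦natmul⟧ k
    ⟦intmul⟧ -[1+ k ] = ≡.cong -_ (⟦natmul⟧ (suc k))

  ⟦L·x₀⟧ : ∀ L y (e : Env n) → ⟦ L · var zero ⟧ᴹ (y ∷ᵃ e) ≡ L ⊛ y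
  ⟦L·x₀⟧ L y e = ⟦·⟧ L (var zero) (y ∷ᵃ e)

  ×ᵢ-homo-⊖ : ∀ k l y → (k ℤ.⊖ l) ×ᵢ y ≈ k ×ₙ y + - (l ×ₙ y)
  ×ᵢ-homo-⊖ k       zero    y = ≈-sym (≈-trans (+-congˡ ε⁻¹≈ε) (+-identityʳ _))
  ×ᵢ-homo-⊖ zero    (suc l) y = ≈-sym (+-identityˡ _)
  ×ᵢ-homo-⊖ (suc k) (suc l) y rewrite ℤ.[1+m]⊖[1+n]≡m⊖n k l = begin
    (k ℤ.⊖ l) ×ᵢ y                      ≈⟨ ×ᵢ-homo-⊖ k l y ⟩
    k ×ₙ y + - (l ×ₙ y)                 ≈⟨ +-identityˡ _ ⟨
    𝟘 + (k ×ₙ y + - (l ×ₙ y))           ≈⟨ +-congʳ (-‿inverseʳ y) ⟨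
    (y + - y) + (k ×ₙ y + - (l ×ₙ y))   ≈⟨ interchange _ _ _ _ ⟩
    (y + k ×ₙ y) + (- y + - (l ×ₙ y))   ≈⟨ +-congˡ (⁻¹-∙-comm y _) ⟩
    suc k ×ₙ y + - (suc l ×ₙ y)         ∎

  ×ᵢ-homo-+ : ∀ a b y → (a ℤ.+ b) ×ᵢ y ≈ a ×ᵢ y + b ×ᵢ y
  ×ᵢ-homo-+ (+ k)    (+ l)    y = ×ₙ-homo-+ y k l
  ×ᵢ-homo-+ (+ k)    -[1+ l ] y = ×ᵢ-homo-⊖ k (suc l) y
  ×ᵢ-homo-+ -[1+ k ] (+ l)    y = ≈-trans (×ᵢ-homo-⊖ l (suc k) y) (+-comm _ _)
  ×ᵢ-homo-+ -[1+ k ] -[1+ l ] y = begin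
    - (suc (suc (k ℕ.+ l)) ×ₙ y)      ≡⟨ ≡.cong (λ j → - (j ×ₙ y)) (ℕ.+-suc (suc k) l) ⟨
    - ((suc k ℕ.+ suc l) ×ₙ y)        ≈⟨ -‿cong (×ₙ-homo-+ y (suc k) (suc l)) ⟩
    - (suc k ×ₙ y + suc l ×ₙ y)       ≈⟨ ⁻¹-∙-comm _ _ ⟨
    - (suc k ×ₙ y) + - (suc l ×ₙ y)   ∎

  -‿distribˡ-×ᵢ : ∀ a y → (ℤ.- a) ×ᵢ y ≈ - (a ×ᵢ y)
  -‿distribˡ-×ᵢ (+ zero)  y = ≈-sym ε⁻¹≈ε
  -‿distribˡ-×ᵢ (+ suc k) y = ≈-refl
  -‿distribˡ-×ᵢ -[1+ k ]  y = ≈-sym (⁻¹-involutive _)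

  record Additive (f : C → C) : Set where
    field
      cong : ∀ {a b} → a ≈ b → f a ≈ f b
      homo : ∀ a b → f (a + b) ≈ f a + f b

    𝟘-homo : f 𝟘 ≈ 𝟘
    𝟘-homo = identityʳ-unique (f 𝟘) (f 𝟘) (≈-trans (≈-sym (homo 𝟘 𝟘)) (cong (+-identityˡ 𝟘)))

    -‿homo : ∀ a → f (- a) ≈ - f a
    -‿homo a = inverseʳ-unique (f a) (f (- a))
      (≈-trans (≈-sym (homo a (- a))) (≈-trans (cong (-‿inverseʳ a)) 𝟘-homo))

    ×ₙ-homo : ∀ k a → f (k ×ₙ a) ≈ k ×ₙ f a
    ×ₙ-homo zero    a = 𝟘-homo
    ×ₙ-homo (suc k) a = ≈-trans (homo a _) (+-congˡ (×ₙ-homo k a))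

    ×ᵢ-homo : ∀ m a → f (m ×ᵢ a) ≈ m ×ᵢ f a
    ×ᵢ-homo (+ k)    a = ×ₙ-homo k a
    ×ᵢ-homo -[1+ k ] a = ≈-trans (-‿homo _) (-‿cong (×ₙ-homo (suc k) a))

  open Additive public

  id-additive : Additive (λ x → x)
  id-additive = record { cong = λ p → p ; homo = λ _ _ → ≈-refl }

  ∘-additive : ∀ {f g} → Additive f → Additive g → Additive (λ x → f (g x))
  ∘-additive f g = record
    { cong = λ p → cong f (cong g p)
    ; homo = λ a b → ≈-trans (cong f (homo g a b)) (homo f _ _) }

  +-additive : ∀ {f g} → Additive f → Additive g → Additive (λ x → f x + g x)
  +-additive f g = record
    { cong = λ p → +-cong (cong f p) (cong g p)
    ; homo = λ a b → ≈-trans (+-cong (homo f a b) (homo g a b)) (interchange _ _ _ _) }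

  𝟘-additive : Additive (λ _ → 𝟘)
  𝟘-additive = record { cong = λ _ → ≈-refl ; homo = λ _ _ → ≈-sym (+-identityˡ 𝟘) }

  ρ-additive : Additive ρ
  ρ-additive = record { cong = ≈-cong ρ ; homo = ρ-homo-+ }

  ρ⁻¹-additive : Additive ρ⁻¹
  ρ⁻¹-additive = record { cong = ≈-cong ρ⁻¹ ; homo = ρ⁻¹-homo-+ }

  ×ᵢ-additive : ∀ m → Additive (m ×ᵢ_)
  ×ᵢ-additive (+ k)    = ×ₙ-additive k
    where
    ×ₙ-additive : ∀ k → Additive (k ×ₙ_)
    ×ₙ-additive zero    = 𝟘-additive
    ×ₙ-additive (suc k) = +-additive id-additive (×ₙ-additive k)
  ×ᵢ-additive -[1+ k ] = ∘-additive -‿additive (×ᵢ-additive (+ suc k))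
    where
    -‿additive : Additive -_
    -‿additive = record { cong = -‿cong ; homo = λ a b → ≈-sym (⁻¹-∙-comm a b) }

  ⊛-additive : ∀ L → Additive (L ⊛_)
  ⊛-additive []      = 𝟘-additive
  ⊛-additive (m ∷ L) =
    +-additive (×ᵢ-additive m) (∘-additive (⊛-additive L) ρ-additive)

  record Positive (f : C → C) : Set where
    field
      additive : Additive f
      positive : ∀ {y} → 𝟘 ⊏ y → 𝟘 ⊏ f y

    mono : ∀ {a b} → a ⊏ b → f a ⊏ f b
    mono {a} {b} a<b =
      from <⇔𝟘<- (<-resp-≈ ≈-refl f[b-a]≈fb-fa (positive (to <⇔𝟘<- a<b)))
      where
      f[b-a]≈fb-fa : f (b + - a) ≈ f b + - f a
      f[b-a]≈fb-fa = ≈-trans (homo additive b (- a)) (+-congˡ (-‿homo additive a))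

    reflects-< : ∀ {a b} → f a ⊏ f b → a ⊏ b
    reflects-< {a} {b} fa<fb = <-cases negated-stable a b (λ a<b → a<b)
      (λ a≈b → ⊥-elim (≈⇒≮ (cong additive a≈b) fa<fb))
      (λ b<a → ⊥-elim (<-asym fa<fb (mono b<a)))

    injective : ∀ {a b} → f a ≈ f b → a ≈ b
    injective {a} {b} fa≈fb = <-cases negated-stable a b
      (λ a<b → ⊥-elim (≈⇒≮ fa≈fb (mono a<b)))
      (λ a≈b → a≈b)
      (λ b<a → ⊥-elim (≈⇒≮ (≈-sym fa≈fb) (mono b<a)))

    ≈-⇔ : ∀ {a b} → (a ≈ b) ⇔ (f a ≈ f b)
    ≈-⇔ = mk⇔ (cong additive) injective

    <-⇔ : ∀ {a b} → (a ⊏ b) ⇔ (f a ⊏ f b)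
    <-⇔ = mk⇔ mono reflects-<

  open Positive public

  mono⇒positive : ∀ {f} → Additive f → (∀ {a b} → a ⊏ b → f a ⊏ f b) →
                  Positive f
  mono⇒positive f-additive f-mono = record
    { additive = f-additive
    ; positive = λ 𝟘<y → <-resp-≈ (𝟘-homo f-additive) ≈-refl (f-mono 𝟘<y) }

  id-positive : Positive (λ x → x)
  id-positive = mono⇒positive id-additive (λ a<b → a<b)

  ∘-positive : ∀ {f g} → Positive f → Positive g → Positive (λ x → f (g x))
  ∘-positive f g = mono⇒positive (∘-additive (additive f) (additive g)) (mono f ∘ mono g)

  ρ-positive : Positive ρ
  ρ-positive = mono⇒positive ρ-additive ρ-mono-<

  ρ⁻¹-positive : Positive ρ⁻¹
  ρ⁻¹-positive = mono⇒positive ρ⁻¹-additive ρ⁻¹-mono-<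

  ρ^ ρ⁻^ : ℕ → C → C
  ρ^ zero    y = y
  ρ^ (suc k) y = ρ (ρ^ k y)
  ρ⁻^ zero    y = y
  ρ⁻^ (suc k) y = ρ⁻¹ (ρ⁻^ k y)

  ⟦ρ^[]⟧ : ∀ k (t : Term n) e → ⟦ ρ^[ k ] t ⟧ᴹ e ≡ ρ^ k (⟦ t ⟧ᴹ e)
  ⟦ρ^[]⟧ zero    t e = ≡.refl
  ⟦ρ^[]⟧ (suc k) t e = ≡.cong ρ (⟦ρ^[]⟧ k t e)

  ρ^-positive : ∀ k → Positive (ρ^ k)
  ρ^-positive zero    = id-positive
  ρ^-positive (suc k) = ∘-positive ρ-positive (ρ^-positive k)

  ρ⁻^-positive : ∀ k → Positive (ρ⁻^ k)
  ρ⁻^-positive zero    = id-positive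
  ρ⁻^-positive (suc k) = ∘-positive ρ⁻¹-positive (ρ⁻^-positive k)

  ρ^-additive : ∀ k → Additive (ρ^ k)
  ρ^-additive = additive ∘ ρ^-positive

  ρ⁻^-additive : ∀ k → Additive (ρ⁻^ k)
  ρ⁻^-additive = additive ∘ ρ⁻^-positive

  ρ-comm⇒ρ⁻¹-comm : ∀ {f} → Additive f → (∀ y → f (ρ y) ≈ ρ (f y)) →
                    ∀ y → f (ρ⁻¹ y) ≈ ρ⁻¹ (f y)
  ρ-comm⇒ρ⁻¹-comm {f} f-additive f-comm y = begin
    f (ρ⁻¹ y)             ≈⟨ ρ⁻¹-ρ _ ⟨
    ρ⁻¹ (ρ (f (ρ⁻¹ y)))   ≈⟨ ≈-cong ρ⁻¹ (f-comm _) ⟨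
    ρ⁻¹ (f (ρ (ρ⁻¹ y)))   ≈⟨ ≈-cong ρ⁻¹ (cong f-additive (ρ-ρ⁻¹ y)) ⟩
    ρ⁻¹ (f y)             ∎

  ρ^-comm-ρ : ∀ k y → ρ^ k (ρ y) ≡ ρ (ρ^ k y)
  ρ^-comm-ρ zero    y = ≡.refl
  ρ^-comm-ρ (suc k) y = ≡.cong ρ (ρ^-comm-ρ k y)

  ρ⁻^-comm-ρ : ∀ k y → ρ⁻^ k (ρ y) ≈ ρ (ρ⁻^ k y)
  ρ⁻^-comm-ρ zero    y = ≈-refl
  ρ⁻^-comm-ρ (suc k) y = begin
    ρ⁻¹ (ρ⁻^ k (ρ y))     ≈⟨ ≈-cong ρ⁻¹ (ρ⁻^-comm-ρ k y) ⟩
    ρ⁻¹ (ρ (ρ⁻^ k y))     ≈⟨ ρ⁻¹-ρ _ ⟩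
    ρ⁻^ k y               ≈⟨ ρ-ρ⁻¹ _ ⟨
    ρ (ρ⁻¹ (ρ⁻^ k y))     ∎

  ρ^-ρ⁻^ : ∀ k y → ρ^ k (ρ⁻^ k y) ≈ y
  ρ^-ρ⁻^ zero    y = ≈-refl
  ρ^-ρ⁻^ (suc k) y = begin
    ρ (ρ^ k (ρ⁻¹ (ρ⁻^ k y)))   ≈⟨ ≈-cong ρ (ρ-comm⇒ρ⁻¹-comm (ρ^-additive k) ρ^-comm _) ⟩
    ρ (ρ⁻¹ (ρ^ k (ρ⁻^ k y)))   ≈⟨ ρ-ρ⁻¹ _ ⟩
    ρ^ k (ρ⁻^ k y)             ≈⟨ ρ^-ρ⁻^ k y ⟩
    y                          ∎
    where
    ρ^-comm : ∀ z → ρ^ k (ρ z) ≈ ρ (ρ^ k z)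
    ρ^-comm z = ≈-reflexive (ρ^-comm-ρ k z)

  ρ⁻^-ρ^ : ∀ k y → ρ⁻^ k (ρ^ k y) ≈ y
  ρ⁻^-ρ^ zero    y = ≈-refl
  ρ⁻^-ρ^ (suc k) y = begin
    ρ⁻¹ (ρ⁻^ k (ρ (ρ^ k y)))   ≈⟨ ≈-cong ρ⁻¹ (ρ⁻^-comm-ρ k _) ⟩
    ρ⁻¹ (ρ (ρ⁻^ k (ρ^ k y)))   ≈⟨ ρ⁻¹-ρ _ ⟩
    ρ⁻^ k (ρ^ k y)             ≈⟨ ρ⁻^-ρ^ k y ⟩
    y                          ∎

  ρ⁻^-+-ρ^ : ∀ j k y → ρ⁻^ (j ℕ.+ k) (ρ^ k y) ≈ ρ⁻^ j y
  ρ⁻^-+-ρ^ zero    k y = ρ⁻^-ρ^ k y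
  ρ⁻^-+-ρ^ (suc j) k y = ≈-cong ρ⁻¹ (ρ⁻^-+-ρ^ j k y)

  ρ⁻^-≈⇔ : ∀ k {y w} → (ρ⁻^ k y ≈ w) ⇔ (y ≈ ρ^ k w)
  ρ⁻^-≈⇔ k = mk⇔
    (λ ρ⁻^y≈w → ≈-trans (≈-sym (ρ^-ρ⁻^ k _)) (cong (ρ^-additive k) ρ⁻^y≈w))
    (λ y≈ρ^w → ≈-trans (cong (ρ⁻^-additive k) y≈ρ^w) (ρ⁻^-ρ^ k _))

  ρ⁻^-<⇔ : ∀ k {y w} → (ρ⁻^ k y ⊏ w) ⇔ (y ⊏ ρ^ k w)
  ρ⁻^-<⇔ k = mk⇔
    (λ ρ⁻^y<w → <-resp-≈ (ρ^-ρ⁻^ k _) ≈-refl (mono (ρ^-positive k) ρ⁻^y<w))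
    (λ y<ρ^w → <-resp-≈ ≈-refl (ρ⁻^-ρ^ k _) (mono (ρ⁻^-positive k) y<ρ^w))

  ⊛-comm-ρ : ∀ L y → L ⊛ ρ y ≈ ρ (L ⊛ y)
  ⊛-comm-ρ []      y = ≈-sym (𝟘-homo ρ-additive)
  ⊛-comm-ρ (m ∷ L) y = ≈-sym (begin
    ρ (m ×ᵢ y + L ⊛ ρ y)       ≈⟨ ρ-homo-+ _ _ ⟩
    ρ (m ×ᵢ y) + ρ (L ⊛ ρ y)   ≈⟨ +-congʳ (×ᵢ-homo ρ-additive m y) ⟩
    m ×ᵢ ρ y + ρ (L ⊛ ρ y)     ≈⟨ +-congˡ (⊛-comm-ρ L (ρ y)) ⟨
    m ×ᵢ ρ y + L ⊛ ρ (ρ y)     ∎)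

  ⊛-comm : ∀ K L y → K ⊛ L ⊛ y ≈ L ⊛ K ⊛ y
  ⊛-comm []      L y = ≈-sym (𝟘-homo (⊛-additive L))
  ⊛-comm (k ∷ K) L y = begin
    k ×ᵢ L ⊛ y + K ⊛ ρ (L ⊛ y)   ≈⟨ +-congʳ (×ᵢ-homo (⊛-additive L) k y) ⟨
    L ⊛ k ×ᵢ y + K ⊛ ρ (L ⊛ y)   ≈⟨ +-congˡ (cong (⊛-additive K) (⊛-comm-ρ L y)) ⟨
    L ⊛ k ×ᵢ y + K ⊛ L ⊛ ρ y     ≈⟨ +-congˡ (⊛-comm K L (ρ y)) ⟩
    L ⊛ k ×ᵢ y + L ⊛ K ⊛ ρ y     ≈⟨ homo (⊛-additive L) _ _ ⟨
    L ⊛ (k ×ᵢ y + K ⊛ ρ y)       ∎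

  shift-⊛ : ∀ j L y → shift j L ⊛ y ≈ ρ^ j (L ⊛ y)
  shift-⊛ zero    L y = ≈-refl
  shift-⊛ (suc j) L y = begin
    𝟘 + shift j L ⊛ ρ y      ≈⟨ +-identityˡ _ ⟩
    shift j L ⊛ ρ y          ≈⟨ shift-⊛ j L (ρ y) ⟩
    ρ^ j (L ⊛ ρ y)           ≈⟨ cong (ρ^-additive j) (⊛-comm-ρ L y) ⟩
    ρ^ j (ρ (L ⊛ y))         ≡⟨ ρ^-comm-ρ j _ ⟩
    ρ (ρ^ j (L ⊛ y))         ∎

  +ₚ-⊛ : ∀ p q y → (p +ₚ q) ⊛ y ≈ p ⊛ y + q ⊛ y
  +ₚ-⊛ []      q       y = ≈-sym (+-identityˡ _)
  +ₚ-⊛ (a ∷ p) []      y = ≈-sym (+-identityʳ _)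
  +ₚ-⊛ (a ∷ p) (b ∷ q) y =
    ≈-trans (+-cong (×ᵢ-homo-+ a b y) (+ₚ-⊛ p q (ρ y))) (interchange _ _ _ _)

  -ₚ-⊛ : ∀ L y → (-ₚ L) ⊛ y ≈ - (L ⊛ y)
  -ₚ-⊛ []      y = ≈-sym ε⁻¹≈ε
  -ₚ-⊛ (m ∷ L) y =
    ≈-trans (+-cong (-‿distribˡ-×ᵢ m y) (-ₚ-⊛ L (ρ y))) (⁻¹-∙-comm _ _)

  1-⊛ : ∀ y → (+ 1 ∷ []) ⊛ y ≈ y
  1-⊛ y = ≈-trans (+-identityʳ _) (+-identityʳ y)

  ⟦_⟧ₗ : Linear n → C → Env n → C
  ⟦ linear K L a ⟧ₗ x e = ρ⁻^ K (L ⊛ x) + ⟦ a ⟧ᴹ e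

  ρ⁻^-shift : ∀ j k L y → ρ⁻^ (j ℕ.+ k) (shift k L ⊛ y) ≈ ρ⁻^ j (L ⊛ y)
  ρ⁻^-shift j k L y = ≈-trans (cong (ρ⁻^-additive (j ℕ.+ k)) (shift-⊛ k L y)) (ρ⁻^-+-ρ^ j k _)

  +ₗ-sound : ∀ (l₁ l₂ : Linear n) x e → ⟦ l₁ +ₗ l₂ ⟧ₗ x e ≈ ⟦ l₁ ⟧ₗ x e + ⟦ l₂ ⟧ₗ x e
  +ₗ-sound (linear K₁ L₁ a₁) (linear K₂ L₂ a₂) x e = begin
    ρ⁻^ (K₁ ℕ.+ K₂) ((shift K₂ L₁ +ₚ shift K₁ L₂) ⊛ x) + (A₁ + A₂)
      ≈⟨ +-congʳ (cong (ρ⁻^-additive (K₁ ℕ.+ K₂)) (+ₚ-⊛ (shift K₂ L₁) (shift K₁ L₂) x)) ⟩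
    ρ⁻^ (K₁ ℕ.+ K₂) (shift K₂ L₁ ⊛ x + shift K₁ L₂ ⊛ x) + (A₁ + A₂)
      ≈⟨ +-congʳ (homo (ρ⁻^-additive (K₁ ℕ.+ K₂)) _ _) ⟩
    ρ⁻^ (K₁ ℕ.+ K₂) (shift K₂ L₁ ⊛ x) + ρ⁻^ (K₁ ℕ.+ K₂) (shift K₁ L₂ ⊛ x) + (A₁ + A₂)
      ≈⟨ +-congʳ (+-cong (ρ⁻^-shift K₁ K₂ L₁ x) ρ⁻^-shift′) ⟩
    ρ⁻^ K₁ (L₁ ⊛ x) + ρ⁻^ K₂ (L₂ ⊛ x) + (A₁ + A₂)
      ≈⟨ interchange _ _ _ _ ⟩
    ρ⁻^ K₁ (L₁ ⊛ x) + A₁ + (ρ⁻^ K₂ (L₂ ⊛ x) + A₂)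
      ∎
    where
    A₁ A₂ : C
    A₁ = ⟦ a₁ ⟧ᴹ e
    A₂ = ⟦ a₂ ⟧ᴹ e
    ρ⁻^-shift′ : ρ⁻^ (K₁ ℕ.+ K₂) (shift K₁ L₂ ⊛ x) ≈ ρ⁻^ K₂ (L₂ ⊛ x)
    ρ⁻^-shift′ rewrite ℕ.+-comm K₁ K₂ = ρ⁻^-shift K₂ K₁ L₂ x

  -ₗ-sound : ∀ (l : Linear n) x e → ⟦ -ₗ l ⟧ₗ x e ≈ - ⟦ l ⟧ₗ x e
  -ₗ-sound (linear K L a) x e = ≈-trans
    (+-congʳ (≈-trans (cong (ρ⁻^-additive K) (-ₚ-⊛ L x)) (-‿homo (ρ⁻^-additive K) _)))
    (⁻¹-∙-comm _ _)

  ρₗ-sound : ∀ (l : Linear n) x e → ⟦ ρₗ l ⟧ₗ x e ≈ ρ (⟦ l ⟧ₗ x e)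
  ρₗ-sound (linear K L a) x e = ≈-trans
    (+-congʳ (≈-trans (cong (ρ⁻^-additive K) (shift-⊛ 1 L x)) (ρ⁻^-comm-ρ K _)))
    (≈-sym (ρ-homo-+ _ _))

  ρ⁻¹ₗ-sound : ∀ (l : Linear n) x e → ⟦ ρ⁻¹ₗ l ⟧ₗ x e ≈ ρ⁻¹ (⟦ l ⟧ₗ x e)
  ρ⁻¹ₗ-sound (linear K L a) x e = ≈-sym (ρ⁻¹-homo-+ _ _)

  linearise-sound : ∀ (t : Term (suc n)) x e → ⟦ t ⟧ᴹ (x ∷ᵃ e) ≈ ⟦ linearise t ⟧ₗ x e
  linearise-sound (var zero)    x e = ≈-sym (≈-trans (+-identityʳ _) (1-⊛ x))
  linearise-sound (var (suc i)) x e = ≈-sym (+-identityˡ _)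
  linearise-sound zer           x e = ≈-sym (+-identityˡ _)
  linearise-sound (s ⊕ t)       x e = ≈-trans
    (+-cong (linearise-sound s x e) (linearise-sound t x e))
    (≈-sym (+ₗ-sound (linearise s) (linearise t) x e))
  linearise-sound (⊖ t)         x e =
    ≈-trans (-‿cong (linearise-sound t x e)) (≈-sym (-ₗ-sound (linearise t) x e))
  linearise-sound (ρ· t)        x e =
    ≈-trans (≈-cong ρ (linearise-sound t x e)) (≈-sym (ρₗ-sound (linearise t) x e))
  linearise-sound (ρ⁻¹· t)      x e =
    ≈-trans (≈-cong ρ⁻¹ (linearise-sound t x e)) (≈-sym (ρ⁻¹ₗ-sound (linearise t) x e))

  ⟦⊖ρ^[]⟧ : ∀ K (a : Term n) e → ρ^ K (- ⟦ a ⟧ᴹ e) ≈ ⟦ ⊖ ρ^[ K ] a ⟧ᴹ e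
  ⟦⊖ρ^[]⟧ K a e =
    ≈-trans (-‿homo (ρ^-additive K) _) (≈-reflexive (≡.cong -_ (≡.sym (⟦ρ^[]⟧ K a e))))

  linear-≈𝟘⇔ : ∀ K L (a : Term n) x e →
               (⟦ linear K L a ⟧ₗ x e ≈ 𝟘) ⇔ (L ⊛ x ≈ ⟦ ⊖ ρ^[ K ] a ⟧ᴹ e)
  linear-≈𝟘⇔ K L a x e =
    ⇔-trans +≈𝟘⇔≈- (⇔-trans (ρ⁻^-≈⇔ K) (≈-resp-⇔ ≈-refl (⟦⊖ρ^[]⟧ K a e)))

  linear-<𝟘⇔ : ∀ K L (a : Term n) x e →
               (⟦ linear K L a ⟧ₗ x e ⊏ 𝟘) ⇔ (L ⊛ x ⊏ ⟦ ⊖ ρ^[ K ] a ⟧ᴹ e)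
  linear-<𝟘⇔ K L a x e =
    ⇔-trans +<𝟘⇔<- (⇔-trans (ρ⁻^-<⇔ K) (<-resp-⇔ ≈-refl (⟦⊖ρ^[]⟧ K a e)))

  SatAtom : Env n → Atom n → Set
  SatAtom e (s ≐ᵃ t) = ⟦ s ⟧ᴹ e ≈ ⟦ t ⟧ᴹ e
  SatAtom e (s ≺ᵃ t) = ⟦ s ⟧ᴹ e ⊏ ⟦ t ⟧ᴹ e

  Stable-SatAtom : ∀ (e : Env n) a → Stable (SatAtom e a)
  Stable-SatAtom e (s ≐ᵃ t) = negated-stable
  Stable-SatAtom e (s ≺ᵃ t) = negated-stable

  SatConstraint : C → Env n → Constraint n → Set
  SatConstraint x e (L ·x≐ b) = L ⊛ x ≈ ⟦ b ⟧ᴹ e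
  SatConstraint x e (L ·x≺ b) = L ⊛ x ⊏ ⟦ b ⟧ᴹ e
  SatConstraint x e (L ·x≻ b) = ⟦ b ⟧ᴹ e ⊏ L ⊛ x

  PositiveCoefficient : Constraint n → Set
  PositiveCoefficient c = Positive (coefficient c ⊛_)

  HasSign : Sign → Poly → Set
  HasSign pos L = ∀ {y} → 𝟘 ⊏ y → 𝟘 ⊏ L ⊛ y
  HasSign zro L = ∀ {y} → 𝟘 ⊏ y → L ⊛ y ≈ 𝟘
  HasSign neg L = ∀ {y} → 𝟘 ⊏ y → L ⊛ y ⊏ 𝟘

  positive-sign⇒positive : ∀ L → HasSign pos L → Positive (L ⊛_)
  positive-sign⇒positive L 𝟘<L = record { additive = ⊛-additive L ; positive = 𝟘<L }

  zero-sign⇒⊛≈𝟘 : ∀ L → HasSign zro L → ∀ y → L ⊛ y ≈ 𝟘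
  zero-sign⇒⊛≈𝟘 L L≈𝟘 y = <-cases negated-stable y 𝟘
    (λ y<𝟘 → ⁻¹-injective (≈-trans (≈-sym (-‿homo (⊛-additive L) y))
                                   (≈-trans (L≈𝟘 (<𝟘⇒𝟘<- y<𝟘)) (≈-sym ε⁻¹≈ε))))
    (λ y≈𝟘 → ≈-trans (cong (⊛-additive L) y≈𝟘) (𝟘-homo (⊛-additive L)))
    L≈𝟘

  negative-sign⇒-ₚ-positive : ∀ L → HasSign neg L → Positive ((-ₚ L) ⊛_)
  negative-sign⇒-ₚ-positive L L<𝟘 = record
    { additive = ⊛-additive (-ₚ L)
    ; positive = λ 𝟘<y → <-resp-≈ ≈-refl (≈-sym (-ₚ-⊛ L _)) (<𝟘⇒𝟘<- (L<𝟘 𝟘<y)) }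

  SatIsolated : C → Env n → Atom n ⊎ Constraint n → Set
  SatIsolated x e = [ SatAtom e , SatConstraint x e ]

  PositiveIsolated : Atom n ⊎ Constraint n → Set
  PositiveIsolated = [ (λ _ → ⊤) , PositiveCoefficient ]

  solve≐-sound : ∀ s L (b : Term n) → HasSign s L → ∀ x e →
                 (L ⊛ x ≈ ⟦ b ⟧ᴹ e) ⇔ SatIsolated x e (solve≐ s L b)
  solve≐-sound pos L b _    x e = ⇔-refl
  solve≐-sound zro L b L≈𝟘 x e = ≈-resp-⇔ (zero-sign⇒⊛≈𝟘 L L≈𝟘 x) ≈-refl
  solve≐-sound neg L b _    x e =
    ⇔-trans -‿≈⇔ (≈-resp-⇔ (≈-sym (-ₚ-⊛ L x)) ≈-refl)

  solve≺-sound : ∀ s L (b : Term n) → HasSign s L → ∀ x e →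
                 (L ⊛ x ⊏ ⟦ b ⟧ᴹ e) ⇔ SatIsolated x e (solve≺ s L b)
  solve≺-sound pos L b _    x e = ⇔-refl
  solve≺-sound zro L b L≈𝟘 x e = <-resp-⇔ (zero-sign⇒⊛≈𝟘 L L≈𝟘 x) ≈-refl
  solve≺-sound neg L b _    x e =
    ⇔-trans -‿anti-<⇔ (<-resp-⇔ ≈-refl (≈-sym (-ₚ-⊛ L x)))

  solve≐-positive : ∀ s L (b : Term n) → HasSign s L → PositiveIsolated (solve≐ s L b)
  solve≐-positive pos L b 𝟘<L = positive-sign⇒positive L 𝟘<L
  solve≐-positive zro L b _   = tt
  solve≐-positive neg L b L<𝟘 = negative-sign⇒-ₚ-positive L L<𝟘

  solve≺-positive : ∀ s L (b : Term n) → HasSign s L → PositiveIsolated (solve≺ s L b)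
  solve≺-positive pos L b 𝟘<L = positive-sign⇒positive L 𝟘<L
  solve≺-positive zro L b _   = tt
  solve≺-positive neg L b L<𝟘 = negative-sign⇒-ₚ-positive L L<𝟘

  SatClause : Env n → Clause n → Set
  SatClause e = All (SatAtom e)

  Refutes : Env n → DNF n → Set
  Refutes e = All (λ c → ¬ SatClause e c)

  SatDNF : Env n → DNF n → Set
  SatDNF e D = ¬ Refutes e D

  Stable-SatClause : ∀ (e : Env n) c → Stable (SatClause e c)
  Stable-SatClause e = Stable-All (Stable-SatAtom e)

  SatDNF-singleton : ∀ (e : Env n) c → SatDNF e (c ∷ []) ⇔ SatClause e c
  SatDNF-singleton e c = mk⇔ (λ s → Stable-SatClause e c (λ ¬sc → s (¬sc ∷ [])))
                             (λ sc R → All.head R sc)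

  SatDNF-atom : ∀ (e : Env n) a → SatDNF e ((a ∷ []) ∷ []) ⇔ SatAtom e a
  SatDNF-atom e a = ⇔-trans (SatDNF-singleton e (a ∷ [])) (mk⇔ All.head (λ p → p ∷ []))

  SatDNF-++ : ∀ (e : Env n) D₁ D₂ → SatDNF e (D₁ ++ D₂) ⇔ (SatDNF e D₁ ∨ᶜ SatDNF e D₂)
  SatDNF-++ e D₁ D₂ = ¬-⇔ (⇔-trans (mk⇔ (++⁻ D₁) (λ (R₁ , R₂) → ++⁺ R₁ R₂))
    (Stable⇒⇔¬¬ (Stable-Refutes D₁) ×-⇔ Stable⇒⇔¬¬ (Stable-Refutes D₂)))
    where
    Stable-Refutes : ∀ D → Stable (Refutes e D)
    Stable-Refutes = Stable-All (λ _ → negated-stable)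

  SatDNF-∧ᵈ : ∀ (e : Env n) D₁ D₂ → SatDNF e (D₁ ∧ᵈ D₂) ⇔ (SatDNF e D₁ × SatDNF e D₂)
  SatDNF-∧ᵈ e D₁ D₂ = mk⇔
    (λ s → (λ R₁ → s (from pairwise (All.map (λ {c₁} ¬s₁ → All.universal
                                               (λ _ s₁₂ → ¬s₁ (++⁻ˡ c₁ s₁₂)) D₂) R₁)))
         , (λ R₂ → s (from pairwise (All.universal (λ c₁ → All.map
                                               (λ ¬s₂ s₁₂ → ¬s₂ (++⁻ʳ c₁ s₁₂)) R₂) D₁))))
    (λ (s₁ , s₂) R → s₁ (All.map (λ h sc₁ → s₂ (All.map (λ ¬s₁₂ sc₂ → ¬s₁₂ (++⁺ sc₁ sc₂)) h))
                                 (to pairwise R)))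
    where
    pairwise : Refutes e (D₁ ∧ᵈ D₂) ⇔
               All (λ c₁ → All (λ c₂ → ¬ SatClause e (c₁ ++ c₂)) D₂) D₁
    pairwise = All-cartesianProductWith _++_ D₁ D₂

  Stable-Sat : ∀ (e : Env n) φ → Stable (Sat M e φ)
  Stable-Sat e ⊥'       = Stable-⊥
  Stable-Sat e (s ≐ t)  = negated-stable
  Stable-Sat e (s ≺ t)  = negated-stable
  Stable-Sat e (¬' φ)   = negated-stable
  Stable-Sat e (φ ∧' ψ) = Stable-× (Stable-Sat e φ) (Stable-Sat e ψ)
  Stable-Sat e (φ ∨' ψ) = negated-stable
  Stable-Sat e (φ ⇒' ψ) = Stable-Π (λ _ → Stable-Sat e ψ)
  Stable-Sat e (∀' φ)   = Stable-Π (λ x → Stable-Sat (x ∷ᵃ e) φ)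
  Stable-Sat e (∃' φ)   = negated-stable

  dnf-sound  : ∀ {φ : Formula n} → QF φ → ∀ e → SatDNF e (dnf φ) ⇔ Sat M e φ
  dnf¬-sound : ∀ {φ : Formula n} → QF φ → ∀ e → SatDNF e (dnf¬ φ) ⇔ (¬ Sat M e φ)

  dnf-sound qf⊥       e = mk⇔ (λ s → s []) ⊥-elim
  dnf-sound (qf≐ s t) e = SatDNF-atom e (s ≐ᵃ t)
  dnf-sound (qf≺ s t) e = SatDNF-atom e (s ≺ᵃ t)
  dnf-sound (qf¬ p)   e = dnf¬-sound p e
  dnf-sound (qf∧ p q) e = ⇔-trans (SatDNF-∧ᵈ e _ _) (dnf-sound p e ×-⇔ dnf-sound q e)
  dnf-sound (qf∨ p q) e = ⇔-trans (SatDNF-++ e _ _) (∨ᶜ-⇔ (dnf-sound p e) (dnf-sound q e))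
  dnf-sound {φ = φ ⇒' ψ} (qf⇒ p q) e = ⇔-trans (SatDNF-++ e _ _)
    (⇔-trans (∨ᶜ-⇔ (dnf¬-sound p e) (dnf-sound q e)) (¬∨ᶜ⇔→ (Stable-Sat e ψ)))

  dnf¬-sound qf⊥       e = mk⇔ (λ _ b → b) (λ _ R → All.head R [])
  dnf¬-sound (qf≐ s t) e = ⇔-trans (SatDNF-++ e _ _)
    (⇔-trans (∨ᶜ-⇔ (SatDNF-atom e _) (SatDNF-atom e _)) (⇔-sym ≉⇔<∨>))
  dnf¬-sound (qf≺ s t) e = ⇔-trans (SatDNF-++ e _ _)
    (⇔-trans (∨ᶜ-⇔ (SatDNF-atom e _) (SatDNF-atom e _)) (⇔-sym ≮⇔≈∨>))
  dnf¬-sound {φ = ¬' φ} (qf¬ p) e =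
    ⇔-trans (dnf-sound p e) (Stable⇒⇔¬¬ (Stable-Sat e φ))
  dnf¬-sound (qf∧ p q) e = ⇔-trans (SatDNF-++ e _ _)
    (⇔-trans (∨ᶜ-⇔ (dnf¬-sound p e) (dnf¬-sound q e)) ¬∨ᶜ¬⇔¬×)
  dnf¬-sound (qf∨ p q) e = ⇔-trans (SatDNF-∧ᵈ e _ _)
    (⇔-trans (dnf¬-sound p e ×-⇔ dnf¬-sound q e) ¬×¬⇔¬∨ᶜ)
  dnf¬-sound {φ = φ ⇒' ψ} (qf⇒ p q) e = ⇔-trans (SatDNF-∧ᵈ e _ _)
    (⇔-trans (dnf-sound p e ×-⇔ dnf¬-sound q e) (×¬⇔¬→ (Stable-Sat e φ)))

  atomFormula-sound : ∀ (e : Env n) a → Sat M e (atomFormula a) ⇔ SatAtom e a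
  atomFormula-sound e (s ≐ᵃ t) = ⇔-refl
  atomFormula-sound e (s ≺ᵃ t) = ⇔-refl

  clauseFormula-sound : ∀ (e : Env n) c → Sat M e (clauseFormula c) ⇔ SatClause e c
  clauseFormula-sound e []      = mk⇔ (λ _ → []) (λ _ b → b)
  clauseFormula-sound e (a ∷ c) = ⇔-trans (atomFormula-sound e a ×-⇔ clauseFormula-sound e c)
                                          (mk⇔ (λ (p , ps) → p ∷ ps) All.uncons)

  dnfFormula-sound : ∀ (e : Env n) D → Sat M e (dnfFormula D) ⇔ SatDNF e D
  dnfFormula-sound e []      = mk⇔ ⊥-elim (λ s → s [])
  dnfFormula-sound e (c ∷ D) = ⇔-trans
    (∨ᶜ-⇔ (⇔-trans (clauseFormula-sound e c) (⇔-sym (SatDNF-singleton e c)))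
          (dnfFormula-sound e D))
    (⇔-sym (SatDNF-++ e (c ∷ []) D))

  infix 4 _≤_
  _≤_ : C → C → Set
  a ≤ b = ¬ b ⊏ a

  ≤-<-trans : ∀ {a b c} → a ≤ b → b ⊏ c → a ⊏ c
  ≤-<-trans {a} {b} {c} a≤b b<c = <-cases negated-stable a c (λ a<c → a<c)
    (λ a≈c → ⊥-elim (a≤b (<-resp-≈ ≈-refl (≈-sym a≈c) b<c)))
    (λ c<a → ⊥-elim (a≤b (<-trans b<c c<a)))

  <-≤-trans : ∀ {a b c} → a ⊏ b → b ≤ c → a ⊏ c
  <-≤-trans {a} {b} {c} a<b b≤c = <-cases negated-stable a c (λ a<c → a<c)
    (λ a≈c → ⊥-elim (b≤c (<-resp-≈ a≈c ≈-refl a<b)))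
    (λ c<a → ⊥-elim (b≤c (<-trans c<a a<b)))

  maximum : ∀ u us → ¬ ¬ Σ C (λ m → m ∈ u ∷ us × All (_≤ m) (u ∷ us))
  maximum u []       k = k (u , here ≡.refl , <-irrefl u ∷ [])
  maximum u (w ∷ us) k = maximum w us λ (m , m∈ , ≤m) → ¬¬-excluded-middle λ
    { (yes m<u) → k (u , here ≡.refl ,
                     <-irrefl u ∷ All.map (λ v≤m u<v → v≤m (<-trans m<u u<v)) ≤m)
    ; (no m≮u)  → k (m , there m∈ , m≮u ∷ ≤m) }

  minimum : ∀ v vs → ¬ ¬ Σ C (λ m → m ∈ v ∷ vs × All (m ≤_) (v ∷ vs))
  minimum v []       k = k (v , here ≡.refl , <-irrefl v ∷ [])
  minimum v (w ∷ vs) k = minimum w vs λ (m , m∈ , m≤) → ¬¬-excluded-middle λ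
    { (yes v<m) → k (v , here ≡.refl ,
                     <-irrefl v ∷ All.map (λ m≤u u<v → m≤u (<-trans u<v v<m)) m≤)
    ; (no v≮m)  → k (m , there m∈ , v≮m ∷ m≤) }

-- Models of MODDAG

module DivisibleGroup (M : Structure) (isModel : Models MODDAG M) where
  open OrderedGroup M (λ φ φ-ax → isModel φ (base φ-ax)) public

  positive-element : ¬ ¬ Σ C (𝟘 ⊏_)
  positive-element k = isModel _ nontriv λ x x≉𝟘 →
    <-cases Stable-⊥ x 𝟘 (λ x<𝟘 → k (- x , <𝟘⇒𝟘<- x<𝟘)) x≉𝟘 (λ 𝟘<x → k (x , 𝟘<x))

  -- Of the two alternatives of Div L, the vanishing of L· contradicts positivity.
  ⊛-surjective : ∀ L → Positive (L ⊛_) → ∀ γ → ¬ ¬ Σ C (λ δ → L ⊛ δ ≈ γ)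
  ⊛-surjective L L-positive γ k = isModel _ (div L)
    ( (λ L·≈𝟘 → positive-element λ (y , 𝟘<y) →
         ≈⇒≮ (≈-sym (≡.subst (_≈ 𝟘) (⟦L·x₀⟧ L y _) (L·≈𝟘 y))) (positive L-positive 𝟘<y))
    , (λ L·-onto → L·-onto γ λ δ L·δ≈γ → k (δ , ≡.subst (_≈ γ) (⟦L·x₀⟧ L δ _) L·δ≈γ)) )

  no-maximum : ∀ a → ¬ ¬ Σ C (a ⊏_)
  no-maximum a k = positive-element λ (y , 𝟘<y) →
    k (a + y , <-resp-≈ (+-identityʳ a) ≈-refl (+-monoʳ-< a 𝟘<y))

  no-minimum : ∀ a → ¬ ¬ Σ C (_⊏ a)
  no-minimum a k = positive-element λ (y , 𝟘<y) →
    k (a + - y , <-resp-≈ ≈-refl (+-identityʳ a) (+-monoʳ-< a (𝟘<⇒-<𝟘 𝟘<y)))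

  -- The midpoint is the preimage of a + b under multiplication by 2.
  dense : ∀ {a b} → a ⊏ b → ¬ ¬ Σ C (λ w → a ⊏ w × w ⊏ b)
  dense {a} {b} a<b k = ⊛-surjective two two-positive (a + b) λ (w , 2w≈a+b) → k
    ( w
    , reflects-< two-positive (<-resp-≈ (≈-sym (two⊛ a)) (≈-sym 2w≈a+b) (+-monoʳ-< a a<b))
    , reflects-< two-positive (<-resp-≈ (≈-sym 2w≈a+b) (≈-sym (two⊛ b)) (+-monoˡ-< b a<b)) )
    where
    two : Poly
    two = + 2 ∷ []
    two⊛ : ∀ y → two ⊛ y ≈ y + y
    two⊛ y = ≈-trans (+-identityʳ _) (+-congˡ (+-identityʳ y))
    two-positive : Positive (two ⊛_)
    two-positive = record
      { additive = ⊛-additive two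
      ; positive = λ {y} 𝟘<y → <-resp-≈ (+-identityˡ 𝟘) (≈-sym (two⊛ y))
          (<-trans (+-monoˡ-< 𝟘 𝟘<y) (+-monoʳ-< y 𝟘<y)) }

  interval : ∀ us vs → All (λ u → All (u ⊏_) vs) us →
             ¬ ¬ Σ C (λ x → All (_⊏ x) us × All (x ⊏_) vs)
  interval []       []       _   k = k (𝟘 , [] , [])
  interval (u ∷ us) []       _   k =
    maximum u us λ (m , _ , ≤m) → no-maximum m λ (x , m<x) →
    k (x , All.map (λ u≤m → ≤-<-trans u≤m m<x) ≤m , [])
  interval []       (v ∷ vs) _   k =
    minimum v vs λ (m , _ , m≤) → no-minimum m λ (x , x<m) →
    k (x , [] , All.map (<-≤-trans x<m) m≤)
  interval (u ∷ us) (v ∷ vs) u<v k =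
    maximum u us λ (m , m∈ , ≤m) → minimum v vs λ (m′ , m′∈ , m′≤) →
    dense (All.lookup (All.lookup u<v m∈) m′∈) λ (x , m<x , x<m′) →
    k (x , All.map (λ u≤m → ≤-<-trans u≤m m<x) ≤m , All.map (<-≤-trans x<m′) m′≤)

  interval-⇔ : ∀ us vs →
    ∃ᶜ (λ x → All (_⊏ x) us × All (x ⊏_) vs) ⇔ All (λ u → All (u ⊏_) vs) us
  interval-⇔ us vs = mk⇔
    (λ ∃x → Stable-All (λ _ → Stable-All (λ _ → negated-stable) vs) us λ ¬u<v →
      ∃x λ x (u<x , x<v) → ¬u<v (All.map (λ u<x → All.map (<-trans u<x) x<v) u<x))
    (λ u<v ∄x → interval us vs u<v λ (x , u<x , x<v) → ∄x x (u<x , x<v))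

  private
    open module ⇔-Reasoning = EquationalReasoning {k = equivalence}

  ⟦·⟧≈ : ∀ L (t : Term n) e → ⟦ L · t ⟧ᴹ e ≈ L ⊛ ⟦ t ⟧ᴹ e
  ⟦·⟧≈ L t e = ≈-reflexive (⟦·⟧ L t e)

  ⊛-substitute : ∀ L₀ {x} (b₀ : Term n) e → L₀ ⊛ x ≈ ⟦ b₀ ⟧ᴹ e →
                 ∀ L → L₀ ⊛ L ⊛ x ≈ ⟦ L · b₀ ⟧ᴹ e
  ⊛-substitute L₀ {x} b₀ e L₀x≈b₀ L =
    ≈-trans (⊛-comm L₀ L x) (≈-trans (cong (⊛-additive L) L₀x≈b₀) (≈-sym (⟦·⟧≈ L b₀ e)))

  substitute-sound : ∀ {L₀ x} (b₀ : Term n) e → Positive (L₀ ⊛_) → L₀ ⊛ x ≈ ⟦ b₀ ⟧ᴹ e →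
                     ∀ c → SatConstraint x e c ⇔ SatAtom e (substitute L₀ b₀ c)
  substitute-sound {L₀ = L₀} b₀ e L₀-positive L₀x≈b₀ (L ·x≐ b) =
    ⇔-trans (≈-⇔ L₀-positive) (≈-resp-⇔ (⊛-substitute L₀ b₀ e L₀x≈b₀ L) (≈-sym (⟦·⟧≈ L₀ b e)))
  substitute-sound {L₀ = L₀} b₀ e L₀-positive L₀x≈b₀ (L ·x≺ b) =
    ⇔-trans (<-⇔ L₀-positive) (<-resp-⇔ (⊛-substitute L₀ b₀ e L₀x≈b₀ L) (≈-sym (⟦·⟧≈ L₀ b e)))
  substitute-sound {L₀ = L₀} b₀ e L₀-positive L₀x≈b₀ (L ·x≻ b) =
    ⇔-trans (<-⇔ L₀-positive) (<-resp-⇔ (≈-sym (⟦·⟧≈ L₀ b e)) (⊛-substitute L₀ b₀ e L₀x≈b₀ L))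

  eliminate-equation : ∀ (e : Env n) {L₀ b₀} cs → (L₀ ·x≐ b₀) ∈ cs → Positive (L₀ ⊛_) →
    ∃ᶜ (λ x → All (SatConstraint x e) cs) ⇔ All (SatAtom e) (map (substitute L₀ b₀) cs)
  eliminate-equation e {L₀} {b₀} cs L₀·x≐b₀∈cs L₀-positive = mk⇔
    (λ ∃x → Stable-All (Stable-SatAtom e) _ λ ¬sat → ∃x λ x sat →
      ¬sat (to (substituteAll (All.lookup sat L₀·x≐b₀∈cs)) sat))
    (λ sat ∄x → ⊛-surjective L₀ L₀-positive (⟦ b₀ ⟧ᴹ e) λ (x , L₀x≈b₀) →
      ∄x x (from (substituteAll L₀x≈b₀) sat))
    where
    substituteAll : ∀ {x} → L₀ ⊛ x ≈ ⟦ b₀ ⟧ᴹ e →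
                    All (SatConstraint x e) cs ⇔ All (SatAtom e) (map (substitute L₀ b₀) cs)
    substituteAll L₀x≈b₀ = All-map-⇔ (substitute-sound b₀ e L₀-positive L₀x≈b₀) cs

  -- The point u at which the bound L·x ∼ a is attained: a < L·x iff u < x.
  Threshold : Env n → Poly × Term n → C → Set
  Threshold e (L , a) u = Positive (L ⊛_) × L ⊛ u ≈ ⟦ a ⟧ᴹ e

  threshold : ∀ (e : Env n) l → Positive (proj₁ l ⊛_) → ¬ ¬ Σ C (Threshold e l)
  threshold e (L , a) L-positive =
    ¬¬-map (λ (u , Lu≈a) → u , L-positive , Lu≈a) (⊛-surjective L L-positive (⟦ a ⟧ᴹ e))

  lowerBound-⇔ : ∀ {x} {e : Env n} {u} l → Threshold e l u →
                 SatConstraint x e (lowerBound l) ⇔ (u ⊏ x)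
  lowerBound-⇔ (L , a) (L-positive , Lu≈a) =
    ⇔-trans (<-resp-⇔ (≈-sym Lu≈a) ≈-refl) (⇔-sym (<-⇔ L-positive))

  upperBound-⇔ : ∀ {x} {e : Env n} {v} k → Threshold e k v →
                 SatConstraint x e (upperBound k) ⇔ (x ⊏ v)
  upperBound-⇔ (K , b) (K-positive , Kv≈b) =
    ⇔-trans (<-resp-⇔ ≈-refl (≈-sym Kv≈b)) (⇔-sym (<-⇔ K-positive))

  compatible-⇔ : ∀ {e : Env n} {u v} l k → Threshold e l u → Threshold e k v →
                 SatAtom e (compatible l k) ⇔ (u ⊏ v)
  compatible-⇔ {e = e} {u} {v} (L , a) (K , b) (L-positive , Lu≈a) (K-positive , Kv≈b) =
    ⇔-trans (<-resp-⇔ Ka≈LKu Lb≈LKv) (⇔-sym (<-⇔ (∘-positive L-positive K-positive)))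
    where
    Ka≈LKu : ⟦ K · a ⟧ᴹ e ≈ L ⊛ K ⊛ u
    Ka≈LKu = ≈-trans (⟦·⟧≈ K a e) (≈-trans (cong (⊛-additive K) (≈-sym Lu≈a)) (⊛-comm K L u))
    Lb≈LKv : ⟦ L · b ⟧ᴹ e ≈ L ⊛ K ⊛ v
    Lb≈LKv = ≈-trans (⟦·⟧≈ L b e) (cong (⊛-additive L) (≈-sym Kv≈b))

  eliminate-bounds : ∀ (e : Env n) ls ks →
    All (PositiveCoefficient ∘ lowerBound) ls → All (PositiveCoefficient ∘ upperBound) ks →
    ∃ᶜ (λ x → All (SatConstraint x e ∘ lowerBound) ls × All (SatConstraint x e ∘ upperBound) ks)
      ⇔ All (SatAtom e) (cartesianProductWith compatible ls ks)
  eliminate-bounds e ls ks ls-positive ks-positive = ⇔-trans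
    (¬¬-⇔ negated-stable
          (Stable-All (λ l → Stable-All (λ k → Stable-SatAtom e (compatible l k)) ks) ls)
          via-thresholds)
    (⇔-sym (All-cartesianProductWith compatible ls ks))
    where
    via-thresholds : ¬ ¬ (
      ∃ᶜ (λ x → All (SatConstraint x e ∘ lowerBound) ls × All (SatConstraint x e ∘ upperBound) ks)
        ⇔ All (λ l → All (λ k → SatAtom e (compatible l k)) ks) ls)
    via-thresholds k =
      ¬¬-choose (λ {l} → threshold e l) ls-positive λ (us , ls~us) →
      ¬¬-choose (λ {k} → threshold e k) ks-positive λ (vs , ks~vs) → k (begin
      ∃ᶜ (λ x → All (SatConstraint x e ∘ lowerBound) ls × All (SatConstraint x e ∘ upperBound) ks)
        ∼⟨ ∃ᶜ-⇔ (λ x → All-along-⇔ (λ {l} → lowerBound-⇔ l) ls~us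
                    ×-⇔ All-along-⇔ (λ {k} → upperBound-⇔ k) ks~vs) ⟩
      ∃ᶜ (λ x → All (_⊏ x) us × All (x ⊏_) vs)
        ∼⟨ interval-⇔ us vs ⟩
      All (λ u → All (u ⊏_) vs) us
        ∼⟨ ⇔-sym (All-along-⇔ (λ {l} lu → All-along-⇔ (λ {k} kv → compatible-⇔ l k lu kv) ks~vs)
                              ls~us) ⟩
      All (λ l → All (λ k → SatAtom e (compatible l k)) ks) ls
        ∎)

  eliminate-sound : ∀ (e : Env n) cs → All PositiveCoefficient cs →
    ∃ᶜ (λ x → All (SatConstraint x e) cs) ⇔ All (SatAtom e) (eliminate cs)
  eliminate-sound e cs cs-positive with equationIn cs in eq
  ... | just (L₀ , b₀) =
    eliminate-equation e cs (equationIn-∈ cs eq) (All.lookup cs-positive (equationIn-∈ cs eq))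
  ... | nothing = ⇔-trans
    (∃ᶜ-⇔ λ x → mk⇔ (λ sat → lowerBounds-All sat , upperBounds-All sat)
                    (λ (lower , upper) → bounds-All⁻ cs eq lower upper))
    (eliminate-bounds e (lowerBounds cs) (upperBounds cs)
                      (lowerBounds-All cs-positive) (upperBounds-All cs-positive))

module FixedOrderType (σ : OrderType) (M : Structure) (isModel : Models (MODDAGρ σ) M) where
  open DivisibleGroup M (λ φ φ-ax → isModel φ (base φ-ax)) public

  private
    open module ⇔-Reasoning = EquationalReasoning {k = equivalence}

  σ-sign : ∀ L → HasSign (σ L) L
  σ-sign L = fromAxiom (σ L) (isModel _ (sign L))
    where
    fromAxiom : ∀ s → M ⊨ SignAx s L → HasSign s L
    fromAxiom pos ax {y} 𝟘<y = ≡.subst (𝟘 ⊏_) (⟦L·x₀⟧ L y _) (ax y 𝟘<y)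
    fromAxiom zro ax {y} 𝟘<y = ≡.subst (_≈ 𝟘) (⟦L·x₀⟧ L y _) (ax y 𝟘<y)
    fromAxiom neg ax {y} 𝟘<y = ≡.subst (_⊏ 𝟘) (⟦L·x₀⟧ L y _) (ax y 𝟘<y)

  isolate≐-sound : ∀ (l : Linear n) x e →
                   (⟦ l ⟧ₗ x e ≈ 𝟘) ⇔ SatIsolated x e (isolate≐ σ l)
  isolate≐-sound (linear K L a) x e =
    ⇔-trans (linear-≈𝟘⇔ K L a x e) (solve≐-sound (σ L) L (⊖ ρ^[ K ] a) (σ-sign L) x e)

  isolate≺-sound : ∀ (l : Linear n) x e →
                   (⟦ l ⟧ₗ x e ⊏ 𝟘) ⇔ SatIsolated x e (isolate≺ σ l)
  isolate≺-sound (linear K L a) x e =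
    ⇔-trans (linear-<𝟘⇔ K L a x e) (solve≺-sound (σ L) L (⊖ ρ^[ K ] a) (σ-sign L) x e)

  isolate-sound : ∀ (a : Atom (suc n)) x e →
                  SatAtom (x ∷ᵃ e) a ⇔ SatIsolated x e (isolate σ a)
  isolate-sound (s ≐ᵃ t) x e = ⇔-trans ≈⇔-≈𝟘 (⇔-trans
    (≈-resp-⇔ (linearise-sound (s ⊕ ⊖ t) x e) ≈-refl) (isolate≐-sound (linearise (s ⊕ ⊖ t)) x e))
  isolate-sound (s ≺ᵃ t) x e = ⇔-trans <⇔-<𝟘 (⇔-trans
    (<-resp-⇔ (linearise-sound (s ⊕ ⊖ t) x e) ≈-refl) (isolate≺-sound (linearise (s ⊕ ⊖ t)) x e))

  isolate-positive : ∀ (a : Atom (suc n)) → PositiveIsolated (isolate σ a)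
  isolate-positive (s ≐ᵃ t) = isolate≐-positive (linearise (s ⊕ ⊖ t))
    where
    isolate≐-positive : ∀ (l : Linear n) → PositiveIsolated (isolate≐ σ l)
    isolate≐-positive (linear K L a) = solve≐-positive (σ L) L (⊖ ρ^[ K ] a) (σ-sign L)
  isolate-positive (s ≺ᵃ t) = isolate≺-positive (linearise (s ⊕ ⊖ t))
    where
    isolate≺-positive : ∀ (l : Linear n) → PositiveIsolated (isolate≺ σ l)
    isolate≺-positive (linear K L a) = solve≺-positive (σ L) L (⊖ ρ^[ K ] a) (σ-sign L)

  eliminateClause-sound : ∀ (e : Env n) c →
    ∃ᶜ (λ x → SatClause (x ∷ᵃ e) c) ⇔ SatClause e (eliminateClause σ c)
  eliminateClause-sound {n} e c = begin
    ∃ᶜ (λ x → SatClause (x ∷ᵃ e) c)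
      ∼⟨ ∃ᶜ-⇔ (λ x → ⇔-trans (All-map-⇔ (λ a → isolate-sound a x e) c)
                             (All-partitionSums isolated)) ⟩
    ∃ᶜ (λ x → SatClause e atoms × All (SatConstraint x e) constraints)
      ∼⟨ ∃ᶜ-×ˡ (Stable-SatClause e atoms) ⟩
    (SatClause e atoms × ∃ᶜ (λ x → All (SatConstraint x e) constraints))
      ∼⟨ ⇔-refl ×-⇔ eliminate-sound e constraints constraints-positive ⟩
    (SatClause e atoms × SatClause e (eliminate constraints))
      ∼⟨ mk⇔ (λ (p , q) → ++⁺ p q) (++⁻ atoms) ⟩
    SatClause e (eliminateClause σ c)
      ∎
    where
    isolated : List (Atom n ⊎ Constraint n)
    isolated = map (isolate σ) c
    atoms : Clause n
    atoms = proj₁ (partitionSums isolated)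
    constraints : List (Constraint n)
    constraints = proj₂ (partitionSums isolated)
    constraints-positive : All PositiveCoefficient constraints
    constraints-positive =
      proj₂ (to (All-partitionSums isolated) (map⁺ (All.universal isolate-positive c)))

  ∃-eliminate-sound : ∀ (e : Env n) D →
                      ∃ᶜ (λ x → SatDNF (x ∷ᵃ e) D) ⇔ Sat M e (∃-eliminate σ D)
  ∃-eliminate-sound e D = begin
    ∃ᶜ (λ x → SatDNF (x ∷ᵃ e) D)
      ∼⟨ ∃ᶜ-¬All¬ D ⟩
    ¬ All (λ c → ¬ ∃ᶜ (λ x → SatClause (x ∷ᵃ e) c)) D
      ∼⟨ ¬-⇔ (All-map-⇔ (λ c → ¬-⇔ (eliminateClause-sound e c)) D) ⟩
    SatDNF e (map (eliminateClause σ) D)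
      ∼⟨ ⇔-sym (dnfFormula-sound e _) ⟩
    Sat M e (∃-eliminate σ D)
      ∎

  qe-sound : ∀ (φ : Formula n) e → Sat M e φ ⇔ Sat M e (qe σ φ)
  qe-sound ⊥'       e = ⇔-refl
  qe-sound (s ≐ t)  e = ⇔-refl
  qe-sound (s ≺ t)  e = ⇔-refl
  qe-sound (¬' φ)   e = ¬-⇔ (qe-sound φ e)
  qe-sound (φ ∧' ψ) e = qe-sound φ e ×-⇔ qe-sound ψ e
  qe-sound (φ ∨' ψ) e = ∨ᶜ-⇔ (qe-sound φ e) (qe-sound ψ e)
  qe-sound (φ ⇒' ψ) e = →-⇔ (qe-sound φ e) (qe-sound ψ e)
  qe-sound (∃' φ)   e = begin
    ∃ᶜ (λ x → Sat M (x ∷ᵃ e) φ)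
      ∼⟨ ∃ᶜ-⇔ (λ x → ⇔-trans (qe-sound φ (x ∷ᵃ e))
                             (⇔-sym (dnf-sound (qf-qe σ φ) (x ∷ᵃ e)))) ⟩
    ∃ᶜ (λ x → SatDNF (x ∷ᵃ e) (dnf (qe σ φ)))
      ∼⟨ ∃-eliminate-sound e _ ⟩
    Sat M e (qe σ (∃' φ))
      ∎
  qe-sound (∀' φ)   e = begin
    (∀ x → Sat M (x ∷ᵃ e) φ)
      ∼⟨ ∀⇔¬∃ᶜ¬ (λ x → Stable-Sat (x ∷ᵃ e) φ) ⟩
    ¬ ∃ᶜ (λ x → ¬ Sat M (x ∷ᵃ e) φ)
      ∼⟨ ¬-⇔ (∃ᶜ-⇔ λ x → ⇔-trans (¬-⇔ (qe-sound φ (x ∷ᵃ e)))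
                                 (⇔-sym (dnf¬-sound (qf-qe σ φ) (x ∷ᵃ e)))) ⟩
    ¬ ∃ᶜ (λ x → SatDNF (x ∷ᵃ e) (dnf¬ (qe σ φ)))
      ∼⟨ ¬-⇔ (∃-eliminate-sound e _) ⟩
    Sat M e (qe σ (∀' φ))
      ∎

lemma2p5 : (σ : OrderType) → Realized σ → QE (MODDAGρ σ)
lemma2p5 σ _ n φ k = k (qe σ φ , qf-qe σ φ , λ M isModel e →
  let open FixedOrderType σ M isModel in to (qe-sound φ e) , from (qe-sound φ e))
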